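{- Up to isomorphism, there exist only finitely many connected cubic girth-regular graphs with signature $(2,2,2)$ and girth at most $5$.
   Context: Graphs are finite and simple; cubic means $3$-regular. For a graph of finite girth $g$, a girth cycle is a cycle of length $g$, and $\epsilon(e)$ is the number of girth cycles containing the edge $e$. The signature of a vertex $v$ with incident edges $e_1,\ldots,e_k$ ordered so that $\epsilon(e_1)\le\cdots\le\epsilon(e_k)$ is $(\epsilon(e_1),\ldots,\epsilon(e_k))$; a graph is girth-regular if all vertices have the same signature (the signature of the graph). -}

module Defs where

open import Data.Nat using (ℕ; zero; suc; _≤_; _<_)
open import Data.Empty using (⊥)
open import Data.Fin using (Fin; zero; suc; inject₁; fromℕ)
open import Data.Bool using (Bool; true; false)
open import Data.List using (List; length; filterᵇ; allFin)
open import Data.Product using (Σ; ∃; ∃-syntax; _×_; _,_)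
open import Data.Sum using (_⊎_)
open import Relation.Nullary using (¬_)
open import Relation.Binary.PropositionalEquality using (_≡_)
open import Function.Definitions using (Injective)
open import Function.Bundles using (_↔_; Inverse)

record Graph : Set where
  field
    n     : ℕ
    adj   : Fin n → Fin n → Bool
    sym   : ∀ u v → adj u v ≡ adj v u
    irrefl : ∀ v → adj v v ≡ false
open Graph public

module _ (G : Graph) where

  Adj : Fin (n G) → Fin (n G) → Set
  Adj u v = adj G u v ≡ true

  degree : Fin (n G) → ℕ
  degree v = length (filterᵇ (adj G v) (allFin (n G)))

  Cubic : Set
  Cubic = ∀ v → degree v ≡ 3

  data Reachable : Fin (n G) → Fin (n G) → Set where
    here : ∀ {u} → Reachable u u
    step : ∀ {u v w} → Adj u v → Reachable v w → Reachable u w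

  Connected : Set
  Connected = ∀ u v → Reachable u v

  -- A cycle of length (suc m), m ≥ 2, given by a cyclic sequence of distinct
  -- vertices c 0, c 1, …, c m with c i ~ c (i+1) and c m ~ c 0.
  record Cycle (m : ℕ) : Set where
    field
      len≥3  : 2 ≤ m
      vtx    : Fin (suc m) → Fin (n G)
      inj    : Injective _≡_ _≡_ vtx
      consec : ∀ (i : Fin m) → Adj (vtx (inject₁ i)) (vtx (suc i))
      close  : Adj (vtx (fromℕ m)) (vtx zero)
  open Cycle public

  EdgeOf : ∀ {m} → Cycle m → Fin (n G) → Fin (n G) → Set
  EdgeOf {m} C u v =
      (∃[ i ] ((vtx C (inject₁ i) ≡ u × vtx C (suc i) ≡ v)
             ⊎ (vtx C (inject₁ i) ≡ v × vtx C (suc i) ≡ u)))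
    ⊎ ((vtx C (fromℕ m) ≡ u × vtx C zero ≡ v)
      ⊎ (vtx C (fromℕ m) ≡ v × vtx C zero ≡ u))

  -- two cyclic sequences describe the same cycle (subgraph) iff they have
  -- the same edge set
  SameCycle : ∀ {m} → Cycle m → Cycle m → Set
  SameCycle C D = ∀ u v → (EdgeOf C u v → EdgeOf D u v) × (EdgeOf D u v → EdgeOf C u v)

  HasGirth : ℕ → Set
  HasGirth zero = ⊥
  HasGirth (suc m) = Cycle m × (∀ k → suc k < suc m → ¬ Cycle k)

  -- for girth g = suc m: the edge {u,v} lies in exactly two girth cycles
  -- (ε({u,v}) = 2), cycles counted as subgraphs
  InExactlyTwoGirthCycles : ℕ → Fin (n G) → Fin (n G) → Set
  InExactlyTwoGirthCycles m u v =
    Σ (Cycle m) λ C₁ → Σ (Cycle m) λ C₂ →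
      EdgeOf C₁ u v × EdgeOf C₂ u v × ¬ SameCycle C₁ C₂ ×
      (∀ (C : Cycle m) → EdgeOf C u v → SameCycle C C₁ ⊎ SameCycle C C₂)

  -- G (of girth suc m) is girth-regular with signature (2,2,2):
  -- every vertex v has signature (2,2,2), i.e. (G being cubic) each edge
  -- incident with v lies in exactly two girth cycles.
  GirthRegular222 : ℕ → Set
  GirthRegular222 m = ∀ v w → Adj v w → InExactlyTwoGirthCycles m v w

record _≅_ (G H : Graph) : Set where
  field
    iso      : Fin (n G) ↔ Fin (n H)
    preserve : ∀ u v → adj G u v ≡ adj H (Inverse.to iso u) (Inverse.to iso v)

module Submission where

-- In such a graph every arc a–v–b lies on exactly one girth cycle: the two
-- girth cycles at each of the three edges at v can only be distributed one
-- to each pair of edges. The girth cycles are thus the faces of a map, and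
-- its flags (a vertex v, an edge va, the face through an arc a–v–b) are
-- permuted by three involutions r₀ (other vertex), r₁ (other edge) and r₂
-- (other face) satisfying the relations (r₀r₂)² = (r₁r₂)³ = (r₀r₁)^g = 1 of
-- the Coxeter group [g,3]. For g = 3, 4, 5 this group is the flag group of
-- the tetrahedron, cube or dodecahedron, of order 24, 48 or 120, so an orbit
-- of flags has at most 120 elements; by connectivity it reaches every
-- vertex. The finiteness of [g,3] is certified by explicit coset tables,
-- checked by evaluation against a general soundness theorem for coset
-- enumeration.

open import Defs hiding (sym)
open import Data.Nat as ℕ using (ℕ; zero; suc; _+_; _≤_; _<_; _<?_; z≤n; s≤s)
import Data.Nat.Properties as ℕP
open import Data.Nat.GeneralisedArithmetic using (fold; fold-+)
open import Data.Fin using (Fin; zero; suc; toℕ; fromℕ; fromℕ<; inject₁; lower₁; _≟_)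
open import Data.Fin.Properties as FinP
  using (any?; toℕ-injective; toℕ-fromℕ; toℕ-inject₁; toℕ-lower₁; inject₁-lower₁; toℕ<n; toℕ≤pred[n])
open import Data.Bool using (Bool; true; false; _∧_)
import Data.Bool.Properties as BoolP
open import Data.List using (List; []; _∷_; _++_; foldl; upTo; iterate; length; filterᵇ; allFin; map; concatMap)
open import Data.List.Properties using (≡-dec)
open import Data.List.Membership.Propositional using (_∈_)
open import Data.List.Membership.Propositional.Properties using (∈-upTo⁺; ∈-filter⁺; ∈-filter⁻; ∈-allFin)
import Data.List.Membership.DecPropositional as DecMembership
open import Data.List.Relation.Unary.All as All using (All; []; _∷_; all?)
import Data.List.Relation.Unary.All.Properties as AllP
open import Data.List.Relation.Unary.Any as Any using (Any; here; there)
import Data.List.Relation.Unary.Any.Properties as AnyP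
open import Data.List.Relation.Unary.AllPairs using ([]; _∷_)
open import Data.List.Relation.Unary.Unique.Propositional using (Unique)
import Data.List.Relation.Unary.Unique.Propositional.Properties as Unique
open import Data.Maybe using (Maybe; just; nothing)
open import Data.Product using (Σ; ∃; _×_; _,_; proj₁; proj₂)
open import Data.Product.Properties using () renaming (≡-dec to ×-≡-dec)
open import Data.Sum using (_⊎_; inj₁; inj₂)
open import Data.Empty using (⊥; ⊥-elim)
import Data.Vec.Functional as Vector
open import Relation.Binary using (DecidableEquality)
open import Relation.Nullary using (¬?; Dec; yes; no)
open import Relation.Nullary.Decidable using (True; toWitness; T?; _×-dec_; _⊎-dec_)
open import Function using (_∘_; Equivalence)
open import Function.Construct.Identity using (↔-id)
open import Relation.Binary.PropositionalEquality

-- The three generators of the flag action: r₀ moves the vertex along the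
-- edge, r₁ moves the edge inside the face, r₂ moves the face across the edge.
data Gen : Set where
  r₀ r₁ r₂ : Gen

_≟ᴳ_ : DecidableEquality Gen
r₀ ≟ᴳ r₀ = yes refl
r₀ ≟ᴳ r₁ = no λ ()
r₀ ≟ᴳ r₂ = no λ ()
r₁ ≟ᴳ r₀ = no λ ()
r₁ ≟ᴳ r₁ = yes refl
r₁ ≟ᴳ r₂ = no λ ()
r₂ ≟ᴳ r₀ = no λ ()
r₂ ≟ᴳ r₁ = no λ ()
r₂ ≟ᴳ r₂ = yes refl

generators : List Gen
generators = r₀ ∷ r₁ ∷ r₂ ∷ []

all-generators : ∀ s → s ∈ generators
all-generators r₀ = here refl
all-generators r₁ = there (here refl)
all-generators r₂ = there (there (here refl))

nth : ∀ {A : Set} → List A → A → ℕ → A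
nth []       d _       = d
nth (x ∷ xs) d zero    = x
nth (x ∷ xs) d (suc i) = nth xs d i

nth-All : ∀ {A : Set} {P : A → Set} {xs d} → All P xs → P d → ∀ i → P (nth xs d i)
nth-All []       pd _       = pd
nth-All (px ∷ _) pd zero    = px
nth-All (_ ∷ ps) pd (suc i) = nth-All ps pd i

rotate : List Gen → List Gen
rotate []      = []
rotate (s ∷ w) = w ++ s ∷ []

rotations : List Gen → List (List Gen)
rotations w = iterate rotate w (length w)

alternate : ℕ → Gen → Gen → List Gen
alternate zero    s t = []
alternate (suc k) s t = s ∷ t ∷ alternate k s t

-- the defining relators (r₀r₂)², (r₁r₂)³, (r₀r₁)^g of the Coxeter group [g,3],
-- with all their rotations
flag-relators : ℕ → List (List Gen)
flag-relators g =
  rotations (alternate 2 r₀ r₂) ++ rotations (alternate 3 r₁ r₂) ++ rotations (alternate g r₀ r₁)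

-- A coset table for a presentation on the generators: the action of each
-- generator on the cosets 0 … size-1, a representative word for every coset
-- (a spanning tree of the table), and the list of deductions (i , p): the
-- i-th relator read from coset p determines its last edge.
record CosetTable : Set where
  field
    size       : ℕ
    action     : Gen → List ℕ
    words      : List (List Gen)
    deductions : List (ℕ × ℕ)

module Verification (relators : List (List Gen)) (T : CosetTable) where
  open CosetTable T

  ρ : Gen → ℕ → ℕ
  ρ s = nth (action s) 0

  word : ℕ → List Gen
  word = nth words []

  -- edges (s , p) of the table whose correctness has been established, that
  -- is, for which s maps the point of coset p to the point of coset ρ s p
  Knowledge : Set
  Knowledge = List (Gen × ℕ)

  _∈?_ : (e : Gen × ℕ) (K : Knowledge) → Dec (e ∈ K)
  _∈?_ = DecMembership._∈?_ (×-≡-dec _≟ᴳ_ ℕ._≟_)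

  -- an edge is known directly, or as the reverse of a known edge, s being an involution
  Known : Knowledge → Gen → ℕ → Set
  Known K s p = (s , p) ∈ K ⊎ ((s , ρ s p) ∈ K × ρ s (ρ s p) ≡ p)

  known? : ∀ K s p → Dec (Known K s p)
  known? K s p = ((s , p) ∈? K) ⊎-dec (((s , ρ s p) ∈? K) ×-dec (ρ s (ρ s p) ℕ.≟ p))

  -- follow a word (last letter first) from coset p along known edges
  trace : Knowledge → ℕ → List Gen → Maybe ℕ
  trace K p [] = just p
  trace K p (s ∷ w) with trace K p w
  ... | nothing = nothing
  ... | just q with known? K s q
  ...   | yes _ = just (ρ s q)
  ...   | no _  = nothing

  -- a relator s w read from coset p closes the edge (s , q) where q ends w
  deduce : Knowledge → ℕ × ℕ → Knowledge
  deduce K (i , p) with nth relators [] i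
  ... | [] = K
  ... | s ∷ w with trace K p w
  ...   | nothing = K
  ...   | just q with ρ s q ℕ.≟ p
  ...     | yes _ = (s , q) ∷ K
  ...     | no _  = K

  -- the spanning tree: coset p is reached from its parent by the first letter of its word
  tree-edges : List ℕ → Knowledge
  tree-edges [] = []
  tree-edges (p ∷ ps) with word p
  ... | [] = tree-edges ps
  ... | s ∷ w with ≡-dec _≟ᴳ_ w (word (ρ s p)) ×-dec (ρ s (ρ s p) ℕ.≟ p)
  ...   | yes _ = (s , ρ s p) ∷ tree-edges ps
  ...   | no _  = tree-edges ps

  knowledge : Knowledge
  knowledge = foldl deduce (tree-edges (upTo size)) deductions

  -- every entry of the table lies in range and is known; the knowledge is
  -- passed as an argument so that it is computed only once
  CompleteFor : Knowledge → Set
  CompleteFor K = All (λ p → All (λ s → ρ s p < size × Known K s p) generators) (upTo size)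

  complete-for? : ∀ K → Dec (CompleteFor K)
  complete-for? K = all? (λ p → all? (λ s → (ρ s p <? size) ×-dec known? K s p) generators) (upTo size)

  Correct : Set
  Correct = word 0 ≡ [] × 0 < size × CompleteFor knowledge

  correct? : Dec Correct
  correct? = ≡-dec _≟ᴳ_ (word 0) [] ×-dec (0 <? size) ×-dec complete-for? knowledge

record VerifiedTable (relators : List (List Gen)) : Set where
  field
    table   : CosetTable
    correct : Verification.Correct relators table

verify : ∀ {relators} (T : CosetTable) {_ : True (Verification.correct? relators T)} → VerifiedTable relators
verify T {c} = record { table = T ; correct = toWitness c }

-- Soundness: a complete verified coset table for relators that hold in an
-- action bounds the orbit of any point by the size of the table.
module Orbit
  {X : Set} (Valid : X → Set) (act : Gen → X → X)
  (act-valid : ∀ s {x} → Valid x → Valid (act s x))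
  (act-involutive : ∀ s {x} → Valid x → act s (act s x) ≡ x) where

  act* : List Gen → X → X
  act* []      x = x
  act* (s ∷ w) x = act s (act* w x)

  act*-valid : ∀ w {x} → Valid x → Valid (act* w x)
  act*-valid []      v = v
  act*-valid (s ∷ w) v = act-valid s (act*-valid w v)

  act*-++ : ∀ u v {x} → act* (u ++ v) x ≡ act* u (act* v x)
  act*-++ []      v = refl
  act*-++ (s ∷ u) v = cong (act s) (act*-++ u v)

  Relation : List Gen → Set
  Relation w = ∀ x → Valid x → act* w x ≡ x

  -- s w = 1 implies w s = 1, since s is an involution
  rotate-relation : ∀ w → Relation w → Relation (rotate w)
  rotate-relation []      rel x vx = refl
  rotate-relation (s ∷ w) rel x vx = begin
    act* (w ++ s ∷ []) x                  ≡⟨ act*-++ w (s ∷ []) ⟩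
    act* w (act s x)                      ≡⟨ sym (act-involutive s (act*-valid w (act-valid s vx))) ⟩
    act s (act s (act* w (act s x)))      ≡⟨ cong (act s) (rel (act s x) (act-valid s vx)) ⟩
    act s (act s x)                       ≡⟨ act-involutive s vx ⟩
    x                                     ∎
    where open ≡-Reasoning

  rotations-relation : ∀ w → Relation w → All Relation (rotations w)
  rotations-relation w = rotated (length w) w
    where
    rotated : ∀ k w → Relation w → All Relation (iterate rotate w k)
    rotated zero    w rel = []
    rotated (suc k) w rel = rel ∷ rotated k (rotate w) (rotate-relation w rel)

  -- an enumeration of (a superset of) the orbit of x₀ by the numbers below N
  record Enumeration (x₀ : X) (N : ℕ) : Set where
    field
      element       : ℕ → X
      element-valid : ∀ p → Valid (element p)
      start         : element 0 ≡ x₀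
      nonempty      : 0 < N
      move          : Gen → ℕ → ℕ
      move-<        : ∀ s {p} → p < N → move s p < N
      move-act      : ∀ s {p} → p < N → act s (element p) ≡ element (move s p)

    move* : List Gen → ℕ → ℕ
    move* []      p = p
    move* (s ∷ w) p = move s (move* w p)

    move*-act : ∀ w {p} → p < N → move* w p < N × act* w (element p) ≡ element (move* w p)
    move*-act []      p<N = p<N , refl
    move*-act (s ∷ w) p<N with move*-act w p<N
    ... | q<N , eq = move-< s q<N , trans (cong (act s) eq) (move-act s q<N)

  module _ {relators : List (List Gen)} (V : VerifiedTable relators)
           (relations : All Relation relators) {x₀ : X} (valid₀ : Valid x₀) where
    open VerifiedTable V
    open CosetTable table
    open Verification relators table

    φ : ℕ → X
    φ p = act* (word p) x₀

    φ-valid : ∀ p → Valid (φ p)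
    φ-valid p = act*-valid (word p) valid₀

    Edge : Gen × ℕ → Set
    Edge (s , p) = act s (φ p) ≡ φ (ρ s p)

    Sound : Knowledge → Set
    Sound = All Edge

    known-sound : ∀ {K s p} → Sound K → Known K s p → Edge (s , p)
    known-sound σ (inj₁ e) = All.lookup σ e
    known-sound {s = s} {p} σ (inj₂ (e , inv)) = begin
      act s (φ p)                           ≡⟨ cong (λ q → act s (φ q)) (sym inv) ⟩
      act s (φ (ρ s (ρ s p)))               ≡⟨ cong (act s) (sym (All.lookup σ e)) ⟩
      act s (act s (φ (ρ s p)))             ≡⟨ act-involutive s (φ-valid (ρ s p)) ⟩
      φ (ρ s p)                             ∎
      where open ≡-Reasoning

    -- (the branches in which trace fails are ruled out by its result just q)
    trace-sound : ∀ {K} → Sound K → ∀ p w {q} → trace K p w ≡ just q → act* w (φ p) ≡ φ q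
    trace-sound σ p [] refl = refl
    trace-sound {K} σ p (s ∷ w) eq with trace K p w in e
    ... | just q with known? K s q
    trace-sound σ p (s ∷ w) refl | just q | yes k =
      trans (cong (act s) (trace-sound σ p w e)) (known-sound σ k)

    deduce-sound : ∀ {K} → Sound K → ∀ d → Sound (deduce K d)
    deduce-sound {K} σ (i , p) with nth relators [] i in r
    ... | [] = σ
    ... | s ∷ w with trace K p w in t
    ...   | nothing = σ
    ...   | just q with ρ s q ℕ.≟ p
    ...     | no _ = σ
    ...     | yes closes = edge ∷ σ
      where
      relation : Relation (s ∷ w)
      relation = subst Relation r (nth-All relations (λ _ _ → refl) i)
      open ≡-Reasoning
      edge : Edge (s , q)
      edge = begin
        act s (φ q)              ≡⟨ cong (act s) (sym (trace-sound σ p w t)) ⟩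
        act s (act* w (φ p))     ≡⟨ relation (φ p) (φ-valid p) ⟩
        φ p                      ≡⟨ cong φ (sym closes) ⟩
        φ (ρ s q)                ∎

    deductions-sound : ∀ {K} → Sound K → ∀ ds → Sound (foldl deduce K ds)
    deductions-sound σ []       = σ
    deductions-sound σ (d ∷ ds) = deductions-sound (deduce-sound σ d) ds

    tree-sound : ∀ ps → Sound (tree-edges ps)
    tree-sound [] = []
    tree-sound (p ∷ ps) with word p in e
    ... | [] = tree-sound ps
    ... | s ∷ w with ≡-dec _≟ᴳ_ w (word (ρ s p)) ×-dec (ρ s (ρ s p) ℕ.≟ p)
    ...   | no _ = tree-sound ps
    ...   | yes (parent , inv) = edge ∷ tree-sound ps
      where
      open ≡-Reasoning
      edge : Edge (s , ρ s p)
      edge = begin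
        act s (act* (word (ρ s p)) x₀)   ≡⟨ cong (λ u → act s (act* u x₀)) (sym parent) ⟩
        act* (s ∷ w) x₀                  ≡⟨ cong (λ u → act* u x₀) (sym e) ⟩
        φ p                              ≡⟨ cong φ (sym inv) ⟩
        φ (ρ s (ρ s p))                  ∎

    knowledge-sound : Sound knowledge
    knowledge-sound = deductions-sound (tree-sound (upTo size)) deductions

    enumerate : Enumeration x₀ size
    enumerate = record
      { element       = φ
      ; element-valid = φ-valid
      ; start         = cong (λ u → act* u x₀) (proj₁ correct)
      ; nonempty      = proj₁ (proj₂ correct)
      ; move          = ρ
      ; move-<        = λ s p<N → proj₁ (entry s p<N)
      ; move-act      = λ s p<N → known-sound knowledge-sound (proj₂ (entry s p<N))
      }
      where
      entry : ∀ s {p} → p < size → ρ s p < size × Known knowledge s p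
      entry s p<N = All.lookup (All.lookup (proj₂ (proj₂ correct)) (∈-upTo⁺ p<N)) (all-generators s)

pigeonhole : ∀ {A : Set} {R : A → A → Set} →
  (∀ {a b} → R a b → R b a) → (∀ {a b c} → R a b → R b c → R a c) →
  ∀ {a b c x y} → R a x ⊎ R a y → R b x ⊎ R b y → R c x ⊎ R c y →
  R a b ⊎ R a c ⊎ R b c
pigeonhole sym′ trans′ (inj₁ ax) (inj₁ bx) _          = inj₁ (trans′ ax (sym′ bx))
pigeonhole sym′ trans′ (inj₂ ay) (inj₂ by) _          = inj₁ (trans′ ay (sym′ by))
pigeonhole sym′ trans′ (inj₁ ax) (inj₂ _)  (inj₁ cx)  = inj₂ (inj₁ (trans′ ax (sym′ cx)))
pigeonhole sym′ trans′ (inj₂ ay) (inj₁ _)  (inj₂ cy)  = inj₂ (inj₁ (trans′ ay (sym′ cy)))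
pigeonhole sym′ trans′ (inj₁ _)  (inj₂ by) (inj₂ cy)  = inj₂ (inj₂ (trans′ by (sym′ cy)))
pigeonhole sym′ trans′ (inj₂ _)  (inj₁ bx) (inj₁ cx)  = inj₂ (inj₂ (trans′ bx (sym′ cx)))

fold-shift : ∀ {A : Set} (f : A → A) k x → fold (f x) f k ≡ f (fold x f k)
fold-shift f zero    x = refl
fold-shift f (suc k) x = cong f (fold-shift f k x)

≥2⇒≢1 : ∀ {m} → 2 ≤ m → m ≢ 1
≥2⇒≢1 (s≤s (s≤s _)) ()

≥2⇒≢0 : ∀ {m} → 2 ≤ m → 0 ≢ m
≥2⇒≢0 (s≤s _) ()

module Positions {m : ℕ} where

  next : Fin (suc m) → Fin (suc m)
  next i with m ℕ.≟ toℕ i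
  ... | yes _  = zero
  ... | no ¬last = suc (lower₁ i ¬last)

  toℕ-next : ∀ i → toℕ i ≢ m → toℕ (next i) ≡ suc (toℕ i)
  toℕ-next i ¬last with m ℕ.≟ toℕ i
  ... | yes last = ⊥-elim (¬last (sym last))
  ... | no ¬last′ = cong suc (toℕ-lower₁ i ¬last′)

  next-last : ∀ i → toℕ i ≡ m → next i ≡ zero
  next-last i last with m ℕ.≟ toℕ i
  ... | yes _ = refl
  ... | no ¬last = ⊥-elim (¬last (sym last))

  next-fromℕ : next (fromℕ m) ≡ zero
  next-fromℕ = next-last (fromℕ m) (toℕ-fromℕ m)

  next-inject₁ : ∀ j → next (inject₁ j) ≡ suc j
  next-inject₁ j = toℕ-injective (trans (toℕ-next (inject₁ j) inner) (cong suc (toℕ-inject₁ j)))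
    where
    inner : toℕ (inject₁ j) ≢ m
    inner e = ℕP.<⇒≢ (toℕ<n j) (trans (sym (toℕ-inject₁ j)) e)

  toℕ-fold : ∀ k → k ≤ m → toℕ (fold zero next k) ≡ k
  toℕ-fold zero    _   = refl
  toℕ-fold (suc k) k<m = trans (toℕ-next _ (λ e → ℕP.<⇒≢ k<m (trans (sym ih) e))) (cong suc ih)
    where
    ih : toℕ (fold zero next k) ≡ k
    ih = toℕ-fold k (ℕP.<⇒≤ k<m)

  position-fold : ∀ i → fold zero next (toℕ i) ≡ i
  position-fold i = toℕ-injective (toℕ-fold (toℕ i) (toℕ≤pred[n] i))

  period : ∀ i → fold i next (suc m) ≡ i
  period i = begin
    fold i next (suc m)                          ≡⟨ cong (λ j → fold j next (suc m)) (sym (position-fold i)) ⟩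
    fold (fold zero next (toℕ i)) next (suc m)   ≡⟨ sym (fold-+ zero next (suc m)) ⟩
    fold zero next (suc m + toℕ i)               ≡⟨ cong (fold zero next) (ℕP.+-comm (suc m) (toℕ i)) ⟩
    fold zero next (toℕ i + suc m)               ≡⟨ fold-+ zero next (toℕ i) ⟩
    fold (fold zero next (suc m)) next (toℕ i)   ≡⟨ cong (λ j → fold j next (toℕ i)) full-turn ⟩
    fold zero next (toℕ i)                       ≡⟨ position-fold i ⟩
    i                                            ∎
    where
    open ≡-Reasoning
    full-turn : fold zero next (suc m) ≡ zero
    full-turn = next-last _ (toℕ-fold m ℕP.≤-refl)

  no-return : 2 ≤ m → ∀ i → next (next i) ≢ i
  no-return 2≤m i eq with toℕ i ℕ.≟ m
  ... | yes last = ≥2⇒≢1 2≤m (trans (sym last) (trans (cong toℕ (sym eq)) two-steps))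
    where
    two-steps : toℕ (next (next i)) ≡ 1
    two-steps = trans (cong (λ j → toℕ (next j)) (next-last i last)) (toℕ-next zero (≥2⇒≢0 2≤m))
  ... | no ¬last with toℕ (next i) ℕ.≟ m
  ...   | yes last′ = ≥2⇒≢1 2≤m (trans (sym last′) (trans (toℕ-next i ¬last) (cong suc i≡0)))
    where
    i≡0 : toℕ i ≡ 0
    i≡0 = cong toℕ (trans (sym eq) (next-last (next i) last′))
  ...   | no ¬last′ = suc-suc≢ (toℕ i) (trans (sym two-steps) (cong toℕ eq))
    where
    two-steps : toℕ (next (next i)) ≡ suc (suc (toℕ i))
    two-steps = trans (toℕ-next (next i) ¬last′) (cong suc (toℕ-next i ¬last))
    suc-suc≢ : ∀ t → suc (suc t) ≢ t
    suc-suc≢ zero    ()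
    suc-suc≢ (suc t) e = suc-suc≢ t (ℕP.suc-injective e)

  prev : Fin (suc m) → Fin (suc m)
  prev i = fold i next m

  next-prev : ∀ i → next (prev i) ≡ i
  next-prev = period

  prev-next : ∀ i → prev (next i) ≡ i
  prev-next i = trans (fold-shift next m i) (period i)

  undo : ∀ k i → fold (fold i prev k) next k ≡ i
  undo zero    i = refl
  undo (suc k) i = begin
    next (fold (prev (fold i prev k)) next k)    ≡⟨ sym (fold-shift next k _) ⟩
    fold (next (prev (fold i prev k))) next k    ≡⟨ cong (λ j → fold j next k) (next-prev _) ⟩
    fold (fold i prev k) next k                  ≡⟨ undo k i ⟩
    i                                            ∎
    where open ≡-Reasoning

  prev-period : ∀ i → fold i prev (suc m) ≡ i
  prev-period i = trans (sym (period _)) (undo (suc m) i)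

module _ (G : Graph) where
  private
    V = Fin (n G)

  adj-sym : ∀ {u v} → Adj G u v → Adj G v u
  adj-sym {u} {v} uv = trans (Graph.sym G v u) uv

  adj? : ∀ u v → Dec (Adj G u v)
  adj? u v = adj G u v BoolP.≟ true

  record Neighbourhood (v a b c : V) : Set where
    field
      adj-a  : Adj G v a
      adj-b  : Adj G v b
      adj-c  : Adj G v c
      a≢b    : a ≢ b
      a≢c    : a ≢ c
      b≢c    : b ≢ c
      covers : ∀ x → Adj G v x → x ≡ a ⊎ x ≡ b ⊎ x ≡ c

  swap₁₂ : ∀ {v a b c} → Neighbourhood v a b c → Neighbourhood v b a c
  swap₁₂ N = record
    { adj-a = adj-b ; adj-b = adj-a ; adj-c = adj-c
    ; a≢b = λ e → a≢b (sym e) ; a≢c = b≢c ; b≢c = a≢c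
    ; covers = λ x vx → reorder (covers x vx) }
    where
    open Neighbourhood N
    reorder : ∀ {x a b c : V} → x ≡ a ⊎ x ≡ b ⊎ x ≡ c → x ≡ b ⊎ x ≡ a ⊎ x ≡ c
    reorder (inj₁ e)        = inj₂ (inj₁ e)
    reorder (inj₂ (inj₁ e)) = inj₁ e
    reorder (inj₂ (inj₂ e)) = inj₂ (inj₂ e)

  swap₂₃ : ∀ {v a b c} → Neighbourhood v a b c → Neighbourhood v a c b
  swap₂₃ N = record
    { adj-a = adj-a ; adj-b = adj-c ; adj-c = adj-b
    ; a≢b = a≢c ; a≢c = a≢b ; b≢c = λ e → b≢c (sym e)
    ; covers = λ x vx → reorder (covers x vx) }
    where
    open Neighbourhood N
    reorder : ∀ {x a b c : V} → x ≡ a ⊎ x ≡ b ⊎ x ≡ c → x ≡ a ⊎ x ≡ c ⊎ x ≡ b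
    reorder (inj₁ e)        = inj₁ e
    reorder (inj₂ (inj₁ e)) = inj₂ (inj₂ e)
    reorder (inj₂ (inj₂ e)) = inj₂ (inj₁ e)

  -- Constructions whose details later proofs never need are kept opaque, so
  -- that only their types are used (and type checking does not unfold them).
  opaque
    neighbourhood : Cubic G → ∀ v → Σ V λ a → Σ V λ b → Σ V λ c → Neighbourhood v a b c
    neighbourhood cubic v = from-list (filterᵇ (adj G v) (allFin (n G))) (cubic v)
      (Unique.filter⁺ (T? ∘ adj G v) (Unique.allFin⁺ (n G)))
      (λ x∈ → Equivalence.to BoolP.T-≡ (proj₂ (∈-filter⁻ (T? ∘ adj G v) {xs = allFin (n G)} x∈)))
      (λ x vx → ∈-filter⁺ (T? ∘ adj G v) (∈-allFin x) (Equivalence.from BoolP.T-≡ vx))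
      where
      from-list : ∀ xs → length xs ≡ 3 → Unique xs → (∀ {x} → x ∈ xs → Adj G v x) →
                  (∀ x → Adj G v x → x ∈ xs) → Σ V λ a → Σ V λ b → Σ V λ c → Neighbourhood v a b c
      from-list (a ∷ b ∷ c ∷ []) refl ((a≢b ∷ a≢c ∷ []) ∷ (b≢c ∷ []) ∷ [] ∷ []) adjacent complete =
        a , b , c , record
          { adj-a = adjacent (here refl) ; adj-b = adjacent (there (here refl))
          ; adj-c = adjacent (there (there (here refl)))
          ; a≢b = a≢b ; a≢c = a≢c ; b≢c = b≢c
          ; covers = λ x vx → position (complete x vx) }
        where
        position : ∀ {x} → x ∈ a ∷ b ∷ c ∷ [] → x ≡ a ⊎ x ≡ b ⊎ x ≡ c
        position (here e)                = inj₁ e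
        position (there (here e))        = inj₂ (inj₁ e)
        position (there (there (here e))) = inj₂ (inj₂ e)

  to-front : ∀ {v a x y z} → Neighbourhood v x y z → a ≡ x ⊎ a ≡ y ⊎ a ≡ z →
             Σ V λ y′ → Σ V λ z′ → Neighbourhood v a y′ z′
  to-front N (inj₁ refl)        = _ , _ , N
  to-front N (inj₂ (inj₁ refl)) = _ , _ , swap₁₂ N
  to-front N (inj₂ (inj₂ refl)) = _ , _ , swap₁₂ (swap₂₃ N)

  opaque
    extend-neighbourhood : Cubic G → ∀ {v a b} → Adj G v a → Adj G v b → a ≢ b → Σ V (Neighbourhood v a b)
    extend-neighbourhood cubic {v} {a} {b} va vb a≢b with neighbourhood cubic v
    ... | x , y , z , N with to-front N (Neighbourhood.covers N a va)
    ... | y′ , z′ , M with Neighbourhood.covers M b vb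
    ...   | inj₁ refl        = ⊥-elim (a≢b refl)
    ...   | inj₂ (inj₁ refl) = z′ , M
    ...   | inj₂ (inj₂ refl) = y′ , swap₂₃ M

  module CycleGeometry {m : ℕ} (C : Cycle G m) where
    open Positions {m}

    private
      w : Fin (suc m) → V
      w = vtx C

    edge-sym : ∀ {u x} → EdgeOf G C u x → EdgeOf G C x u
    edge-sym (inj₁ (j , inj₁ e)) = inj₁ (j , inj₂ e)
    edge-sym (inj₁ (j , inj₂ e)) = inj₁ (j , inj₁ e)
    edge-sym (inj₂ (inj₁ e))     = inj₂ (inj₂ e)
    edge-sym (inj₂ (inj₂ e))     = inj₂ (inj₁ e)

    edge-adj : ∀ {u x} → EdgeOf G C u x → Adj G u x
    edge-adj (inj₁ (j , inj₁ (refl , refl))) = consec C j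
    edge-adj (inj₁ (j , inj₂ (refl , refl))) = adj-sym (consec C j)
    edge-adj (inj₂ (inj₁ (refl , refl)))     = close C
    edge-adj (inj₂ (inj₂ (refl , refl)))     = adj-sym (close C)

    Joins : V → V → Fin (suc m) → Fin (suc m) → Set
    Joins u x i j = (w i ≡ u × w j ≡ x) ⊎ (w i ≡ x × w j ≡ u)

    edge-next : ∀ i → EdgeOf G C (w i) (w (next i))
    edge-next i with toℕ i ℕ.≟ m
    ... | yes last =
      inj₂ (inj₁ (cong w (sym i≡last) , cong w (sym (trans (cong next i≡last) next-fromℕ))))
      where
      i≡last : i ≡ fromℕ m
      i≡last = toℕ-injective (trans last (sym (toℕ-fromℕ m)))
    ... | no ¬last =
      inj₁ (j , inj₁ (cong w (sym i≡j) , cong w (sym (trans (cong next i≡j) (next-inject₁ j)))))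
      where
      j : Fin m
      j = lower₁ i (λ e → ¬last (sym e))
      i≡j : i ≡ inject₁ j
      i≡j = sym (inject₁-lower₁ i _)

    edge-position : ∀ {u x} → EdgeOf G C u x → Σ (Fin (suc m)) λ i → Joins u x i (next i)
    edge-position (inj₁ (j , o)) = inject₁ j , subst (Joins _ _ _) (sym (next-inject₁ j)) o
    edge-position (inj₂ o)       = fromℕ m , subst (Joins _ _ _) (sym next-fromℕ) o

    edge-prev : ∀ i → EdgeOf G C (w i) (w (prev i))
    edge-prev i = edge-sym (subst (λ j → EdgeOf G C (w (prev i)) (w j)) (next-prev i) (edge-next (prev i)))

    on-cycle : ∀ {u x} → EdgeOf G C u x → Σ (Fin (suc m)) λ k → w k ≡ u
    on-cycle e with edge-position e
    ... | i , inj₁ (ei , _) = i , ei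
    ... | i , inj₂ (_ , ei) = next i , ei

    cycle-neighbour : ∀ {k x} → EdgeOf G C (w k) x → x ≡ w (next k) ⊎ x ≡ w (prev k)
    cycle-neighbour {k} e with edge-position e
    ... | i , inj₁ (ei , ex) = inj₁ (trans (sym ex) (cong (λ j → w (next j)) (inj C ei)))
    ... | i , inj₂ (ex , ei) =
      inj₂ (trans (sym ex) (cong w (trans (sym (prev-next i)) (cong prev (inj C ei)))))

    next≢prev : ∀ k → w (next k) ≢ w (prev k)
    next≢prev k e = no-return (len≥3 C) k (trans (cong next (inj C e)) (next-prev k))

    at-most-two : ∀ {v a b c} → EdgeOf G C v a → EdgeOf G C v b → EdgeOf G C v c → a ≡ b ⊎ a ≡ c ⊎ b ≡ c
    at-most-two ea eb ec with on-cycle ea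
    ... | k , refl =
      pigeonhole {R = _≡_} sym trans (cycle-neighbour ea) (cycle-neighbour eb) (cycle-neighbour ec)

    another-neighbour : ∀ {v a} → EdgeOf G C v a → Σ V λ x → EdgeOf G C v x × x ≢ a
    another-neighbour ea with on-cycle ea
    ... | k , refl with cycle-neighbour ea
    ...   | inj₁ refl = w (prev k) , edge-prev k , λ e → next≢prev k (sym e)
    ...   | inj₂ refl = w (next k) , edge-next k , next≢prev k

    orientation : ∀ {v a b} → EdgeOf G C v a → EdgeOf G C v b → a ≢ b →
      Σ (Fin (suc m)) λ k → w k ≡ v × ((a ≡ w (prev k) × b ≡ w (next k)) ⊎ (a ≡ w (next k) × b ≡ w (prev k)))
    orientation ea eb a≢b with on-cycle ea
    ... | k , refl with cycle-neighbour ea | cycle-neighbour eb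
    ...   | inj₁ an | inj₁ bn = ⊥-elim (a≢b (trans an (sym bn)))
    ...   | inj₁ an | inj₂ bp = k , refl , inj₂ (an , bp)
    ...   | inj₂ ap | inj₁ bn = k , refl , inj₁ (ap , bn)
    ...   | inj₂ ap | inj₂ bp = ⊥-elim (a≢b (trans ap (sym bp)))

    prev-no-return : ∀ i → prev (prev i) ≢ i
    prev-no-return i e = no-return (len≥3 C) i (sym (trans (sym back) (cong (λ j → next (next j)) e)))
      where
      back : next (next (prev (prev i))) ≡ i
      back = trans (cong next (next-prev (prev i))) (next-prev i)

  record CycleWalk {m} (C : Cycle G m) : Set where
    field
      at       : ℕ → V
      along    : ∀ k → EdgeOf G C (at k) (at (suc k))
      no-turn  : ∀ k → at (2 + k) ≢ at k
      periodic : ∀ k → at (k + suc m) ≡ at k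

  module _ {m : ℕ} (C : Cycle G m) where
    open Positions {m}
    open CycleGeometry C

    private
      w : Fin (suc m) → V
      w = vtx C

    walk-by : (advance : Fin (suc m) → Fin (suc m)) → (∀ i → EdgeOf G C (w i) (w (advance i))) →
              (∀ i → advance (advance i) ≢ i) → (∀ i → fold i advance (suc m) ≡ i) → Fin (suc m) → CycleWalk C
    walk-by advance along no-turn period c = record
      { at       = λ k → w (fold c advance k)
      ; along    = λ k → along (fold c advance k)
      ; no-turn  = λ k e → no-turn (fold c advance k) (inj C e)
      ; periodic = λ k → cong w (trans (fold-+ c advance k) (cong (λ j → fold j advance k) (period c)))
      }

    walk-through : ∀ {v a b} → EdgeOf G C v a → EdgeOf G C v b → a ≢ b →
                   Σ (CycleWalk C) λ W → CycleWalk.at W 0 ≡ a × CycleWalk.at W 1 ≡ v × CycleWalk.at W 2 ≡ b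
    walk-through ea eb a≢b with orientation ea eb a≢b
    ... | k , refl , inj₁ (refl , refl) =
      walk-by next edge-next (no-return (len≥3 C)) period (prev k) ,
      refl , cong w (next-prev k) , cong (λ j → w (next j)) (next-prev k)
    ... | k , refl , inj₂ (refl , refl) =
      walk-by prev edge-prev prev-no-return prev-period (next k) ,
      refl , cong w (prev-next k) , cong (λ j → w (prev j)) (prev-next k)

  module _ {m : ℕ} where
    Through : Cycle G m → V → V → V → Set
    Through C a v b = EdgeOf G C v a × EdgeOf G C v b

    same-sym : ∀ (C D : Cycle G m) → SameCycle G C D → SameCycle G D C
    same-sym C D same u v = proj₂ (same u v) , proj₁ (same u v)

    same-trans : ∀ (C D E : Cycle G m) → SameCycle G C D → SameCycle G D E → SameCycle G C E
    same-trans C D E CD DE u v = proj₁ (DE u v) ∘ proj₁ (CD u v) , proj₂ (CD u v) ∘ proj₂ (DE u v)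

    transport : ∀ (C D : Cycle G m) → SameCycle G C D → ∀ {u v} → EdgeOf G C u v → EdgeOf G D u v
    transport C D same {u} {v} = proj₁ (same u v)

    not-all-three : ∀ {v a b c} (C : Cycle G m) → Neighbourhood v a b c →
                    EdgeOf G C v a → EdgeOf G C v b → EdgeOf G C v c → ⊥
    not-all-three C N ea eb ec with CycleGeometry.at-most-two C ea eb ec
    ... | inj₁ e        = Neighbourhood.a≢b N e
    ... | inj₂ (inj₁ e) = Neighbourhood.a≢c N e
    ... | inj₂ (inj₂ e) = Neighbourhood.b≢c N e

    continues : ∀ {v a b c} (C : Cycle G m) → Neighbourhood v a b c →
                EdgeOf G C v a → EdgeOf G C v b ⊎ EdgeOf G C v c
    continues C N ea with CycleGeometry.another-neighbour C ea
    ... | x , ex , x≢a with Neighbourhood.covers N x (CycleGeometry.edge-adj C ex)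
    ...   | inj₁ x≡a        = ⊥-elim (x≢a x≡a)
    ...   | inj₂ (inj₁ refl) = inj₁ ex
    ...   | inj₂ (inj₂ refl) = inj₂ ex

    two-cycles : ∀ {u v} (C₁ C₂ C₃ : Cycle G m) → InExactlyTwoGirthCycles G m u v →
      EdgeOf G C₁ u v → EdgeOf G C₂ u v → EdgeOf G C₃ u v →
      SameCycle G C₁ C₂ ⊎ SameCycle G C₁ C₃ ⊎ SameCycle G C₂ C₃
    two-cycles C₁ C₂ C₃ (E₁ , E₂ , _ , _ , _ , only) e₁ e₂ e₃ =
      pigeonhole {R = SameCycle G} (λ {C} {D} → same-sym C D) (λ {C} {D} {E} → same-trans C D E)
                 {C₁} {C₂} {C₃} {E₁} {E₂} (only C₁ e₁) (only C₂ e₂) (only C₃ e₃)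

    -- In a girth-regular graph of signature (2,2,2) every arc lies on exactly
    -- one girth cycle: with neighbours a, b, c of v, the two cycles through va
    -- and the two through vb and vc leave no room for any other distribution.
    module UniqueCycles (regular : GirthRegular222 G m) where

      arc-cycle : ∀ {v a b c} → Neighbourhood v a b c → Σ (Cycle G m) λ C → Through C a v b
      arc-cycle {v} {a} {b} {c} N with regular v a (Neighbourhood.adj-a N)
      ... | C₁ , C₂ , a₁ , a₂ , C₁≉C₂ , _ with continues C₁ N a₁ | continues C₂ N a₂
      ...   | inj₁ b₁ | _       = C₁ , a₁ , b₁
      ...   | inj₂ _  | inj₁ b₂ = C₂ , a₂ , b₂
      ...   | inj₂ c₁ | inj₂ c₂ with regular v b (Neighbourhood.adj-b N)
      ...     | D , _ , b₃ , _ with continues D (swap₁₂ N) b₃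
      ...       | inj₁ a₃ = D , a₃ , b₃
      ...       | inj₂ c₃ with two-cycles C₁ C₂ D (regular v c (Neighbourhood.adj-c N)) c₁ c₂ c₃
      ...         | inj₁ C₁≈C₂        = ⊥-elim (C₁≉C₂ C₁≈C₂)
      ...         | inj₂ (inj₁ C₁≈D) = ⊥-elim (not-all-three D N (transport C₁ D C₁≈D a₁) b₃ c₃)
      ...         | inj₂ (inj₂ C₂≈D) = ⊥-elim (not-all-three D N (transport C₂ D C₂≈D a₂) b₃ c₃)

      arc-cycle-unique : ∀ {v a b c} → Neighbourhood v a b c → ∀ (C D : Cycle G m) →
                         Through C a v b → Through D a v b → SameCycle G C D
      arc-cycle-unique {v} {a} {b} {c} N C D (aC , bC) (aD , bD) with arc-cycle (swap₂₃ N)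
      ... | F , aF , cF with two-cycles C D F (regular v a (Neighbourhood.adj-a N)) aC aD aF
      ...   | inj₁ C≈D        = C≈D
      ...   | inj₂ (inj₁ C≈F) = ⊥-elim (not-all-three F N aF (transport C F C≈F bC) cF)
      ...   | inj₂ (inj₂ D≈F) = ⊥-elim (not-all-three F N aF (transport D F D≈F bD) cF)

    module Faces (cubic : Cubic G) (regular : GirthRegular222 G m) where
      open UniqueCycles regular
      open CycleGeometry using (edge-sym; edge-adj; at-most-two; another-neighbour)

      Arc : V → V → V → Set
      Arc p q r = Adj G q p × Adj G q r × p ≢ r

      arc? : ∀ p q r → Dec (Arc p q r)
      arc? p q r = adj? q p ×-dec adj? q r ×-dec ¬? (p ≟ r)

      arc-flip : ∀ {p q r} → Arc p q r → Arc r q p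
      arc-flip (qp , qr , p≢r) = qr , qp , λ e → p≢r (sym e)

      opaque
        girth-cycle : ∀ {p q r} → Arc p q r → Σ (Cycle G m) λ C → Through C p q r
        girth-cycle (qp , qr , p≢r) = arc-cycle (proj₂ (extend-neighbourhood cubic qp qr p≢r))

        girth-cycle-unique : ∀ {p q r} → Arc p q r → ∀ C D →
                             Through C p q r → Through D p q r → SameCycle G C D
        girth-cycle-unique (qp , qr , p≢r) = arc-cycle-unique (proj₂ (extend-neighbourhood cubic qp qr p≢r))

      ContinuesTo : V → V → V → V → Set
      ContinuesTo p q r x = Σ (Cycle G m) λ C → Through C p q r × EdgeOf G C r x × x ≢ q

      opaque
        continuation : ∀ {p q r} (arc : Arc p q r) →
                       Σ V λ x → EdgeOf G (proj₁ (girth-cycle arc)) r x × x ≢ q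
        continuation arc = another-neighbour C (edge-sym C (proj₂ (proj₂ (girth-cycle arc))))
          where
          C : Cycle G m
          C = proj₁ (girth-cycle arc)

        successor : V → V → V → V
        successor p q r with arc? p q r
        ... | yes arc = proj₁ (continuation arc)
        ... | no _    = r

        successor-spec : ∀ {p q r} → Arc p q r → ContinuesTo p q r (successor p q r)
        successor-spec {p} {q} {r} arc with arc? p q r
        ... | yes arc′ = proj₁ (girth-cycle arc′) , proj₂ (girth-cycle arc′) , proj₂ (continuation arc′)
        ... | no ¬arc  = ⊥-elim (¬arc arc)

      successor-unique : ∀ {p q r x} (C : Cycle G m) → Arc p q r → Through C p q r →
                         EdgeOf G C r x → x ≢ q → successor p q r ≡ x
      successor-unique {p} {q} {r} {x} C arc through rx x≢q with successor-spec arc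
      ... | D , throughD , rs , s≢q = conclude (at-most-two C (edge-sym C (proj₂ through)) rx rs′)
        where
        rs′ : EdgeOf G C r (successor p q r)
        rs′ = transport D C (girth-cycle-unique arc D C throughD through) rs
        conclude : q ≡ x ⊎ q ≡ successor p q r ⊎ x ≡ successor p q r → successor p q r ≡ x
        conclude (inj₁ q≡x)        = ⊥-elim (x≢q (sym q≡x))
        conclude (inj₂ (inj₁ q≡s)) = ⊥-elim (s≢q (sym q≡s))
        conclude (inj₂ (inj₂ x≡s)) = sym x≡s

      successor-arc : ∀ {p q r} → Arc p q r → Arc q r (successor p q r)
      successor-arc arc with successor-spec arc
      ... | C , (_ , qr) , rs , s≢q = adj-sym (edge-adj C qr) , edge-adj C rs , λ e → s≢q (sym e)

      successor-reverse : ∀ {p q r} → Arc p q r → successor (successor p q r) r q ≡ p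
      successor-reverse arc@(_ , _ , p≢r) with successor-spec arc
      ... | C , (qp , qr) , rs , _ =
        successor-unique C (arc-flip (successor-arc arc)) (rs , edge-sym C qr) qp p≢r

      successor-distinct : ∀ {v a b c} → Neighbourhood v a b c → successor b v a ≢ successor c v a
      successor-distinct {v} {a} {b} {c} N e = combine (successor-spec arc-bva) (successor-spec arc-cva)
        where
        open Neighbourhood N
        arc-bva : Arc b v a
        arc-bva = adj-b , adj-a , λ e → a≢b (sym e)
        arc-cva : Arc c v a
        arc-cva = adj-c , adj-a , λ e → a≢c (sym e)
        combine : ContinuesTo b v a (successor b v a) → ContinuesTo c v a (successor c v a) → ⊥
        combine (C₁ , (vb , va) , ax , _) (C₂ , (vc , va′) , ay , _) =
          not-all-three C₁ N va vb (transport C₂ C₁ same vc)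
          where
          same : SameCycle G C₂ C₁
          same = girth-cycle-unique (successor-arc arc-bva) C₂ C₁
                   (edge-sym C₂ va′ , subst (EdgeOf G C₂ a) (sym e) ay) (edge-sym C₁ va , ax)

      successor-walk : ∀ {C : Cycle G m} (W : CycleWalk C) k → let open CycleWalk W in
                       successor (at k) (at (1 + k)) (at (2 + k)) ≡ at (3 + k)
      successor-walk {C} W k =
        successor-unique C arc (edge-sym C (along k) , along (1 + k)) (along (2 + k)) (no-turn (1 + k))
        where
        open CycleWalk W
        arc : Arc (at k) (at (1 + k)) (at (2 + k))
        arc = edge-adj C (edge-sym C (along k)) , edge-adj C (along (1 + k)) , λ e → no-turn k (sym e)

      complete-neighbourhood : ∀ {v a b c} → Adj G v a → Adj G v b → Adj G v c →
                               a ≢ b → a ≢ c → b ≢ c → Neighbourhood v a b c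
      complete-neighbourhood {v} {a} {b} {c} va vb vc a≢b a≢c b≢c =
        identify (extend-neighbourhood cubic va vb a≢b)
        where
        identify : Σ V (Neighbourhood v a b) → Neighbourhood v a b c
        identify (d , N) with Neighbourhood.covers N c vc
        ... | inj₁ c≡a        = ⊥-elim (a≢c (sym c≡a))
        ... | inj₂ (inj₁ c≡b) = ⊥-elim (b≢c (sym c≡b))
        ... | inj₂ (inj₂ refl) = N

      opaque
        third : V → V → V → V
        third v a b with any? (λ x → adj? v x ×-dec ¬? (x ≟ a) ×-dec ¬? (x ≟ b))
        ... | yes (x , _) = x
        ... | no _        = b

        third-spec : ∀ {v a b c} → Neighbourhood v a b c → third v a b ≡ c
        third-spec {v} {a} {b} {c} N with any? (λ x → adj? v x ×-dec ¬? (x ≟ a) ×-dec ¬? (x ≟ b))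
        ... | yes (x , vx , x≢a , x≢b) = only (Neighbourhood.covers N x vx)
          where
          only : x ≡ a ⊎ x ≡ b ⊎ x ≡ c → x ≡ c
          only (inj₁ x≡a)        = ⊥-elim (x≢a x≡a)
          only (inj₂ (inj₁ x≡b)) = ⊥-elim (x≢b x≡b)
          only (inj₂ (inj₂ x≡c)) = x≡c
        ... | no none = ⊥-elim (none (c , adj-c , (λ e → a≢c (sym e)) , λ e → b≢c (sym e)))
          where open Neighbourhood N

      -- A flag: a vertex, the edge to edge-end and the face through the arc
      -- edge-end–vertex–face-end.
      record Flag : Set where
        constructor flag
        field
          vertex edge-end face-end : V
      open Flag

      flag-≡ : ∀ {v a b v′ a′ b′} → v ≡ v′ → a ≡ a′ → b ≡ b′ → flag v a b ≡ flag v′ a′ b′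
      flag-≡ refl refl refl = refl

      ValidFlag : Flag → Set
      ValidFlag (flag v a b) = Arc a v b

      act : Gen → Flag → Flag
      act r₀ (flag v a b) = flag a v (successor b v a)
      act r₁ (flag v a b) = flag v b a
      act r₂ (flag v a b) = flag v a (third v a b)

      act-valid : ∀ s {F} → ValidFlag F → ValidFlag (act s F)
      act-valid r₀ arc = successor-arc (arc-flip arc)
      act-valid r₁ arc = arc-flip arc
      act-valid r₂ {flag v a b} (va , vb , a≢b) =
        let c , N = extend-neighbourhood cubic va vb a≢b
        in subst (Arc a v) (sym (third-spec N)) (va , Neighbourhood.adj-c N , Neighbourhood.a≢c N)

      act-involutive : ∀ s {F} → ValidFlag F → act s (act s F) ≡ F
      act-involutive r₀ {flag v a b} arc = cong (flag v a) (successor-reverse (arc-flip arc))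
      act-involutive r₁ _ = refl
      act-involutive r₂ {flag v a b} (va , vb , a≢b) =
        let c , N = extend-neighbourhood cubic va vb a≢b
        in cong (flag v a) (trans (cong (third v a) (third-spec N)) (third-spec (swap₂₃ N)))

      open Orbit ValidFlag act act-valid act-involutive

      -- the two faces at an edge are swapped by r₂ on either side: (r₀ r₂)² = 1
      relation-02 : Relation (alternate 2 r₀ r₂)
      relation-02 (flag v a b) arc@(va , vb , a≢b) = cong (flag v a) (begin
        successor (third a v (successor (third v a b) v a)) a v
          ≡⟨ cong (λ t → successor (third a v (successor t v a)) a v) (third-spec N) ⟩
        successor (third a v (successor c v a)) a v
          ≡⟨ cong (λ t → successor t a v) (third-spec M) ⟩
        successor (successor b v a) a v
          ≡⟨ successor-reverse (arc-flip arc) ⟩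
        b ∎)
        where
        open ≡-Reasoning
        c : V
        c = proj₁ (extend-neighbourhood cubic va vb a≢b)
        N : Neighbourhood v a b c
        N = proj₂ (extend-neighbourhood cubic va vb a≢b)
        M : Neighbourhood a v (successor c v a) (successor b v a)
        M = from-arcs (successor-arc (arc-flip (va , Neighbourhood.adj-c N , Neighbourhood.a≢c N)))
                      (successor-arc (arc-flip arc))
          where
          from-arcs : Arc v a (successor c v a) → Arc v a (successor b v a) →
                      Neighbourhood a v (successor c v a) (successor b v a)
          from-arcs (av , ay , v≢y) (_ , ax , v≢x) =
            complete-neighbourhood av ay ax v≢y v≢x (successor-distinct (swap₂₃ N))

      -- the three faces at a vertex: (r₁ r₂)³ = 1
      relation-12 : Relation (alternate 3 r₁ r₂)
      relation-12 (flag v a b) (va , vb , a≢b) = rotate-thirds (proj₂ (extend-neighbourhood cubic va vb a≢b))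
        where
        rotate-thirds : ∀ {c} → Neighbourhood v a b c → act* (alternate 3 r₁ r₂) (flag v a b) ≡ flag v a b
        rotate-thirds N
          rewrite third-spec N | third-spec (swap₁₂ (swap₂₃ N)) | third-spec (swap₂₃ (swap₁₂ N)) = refl

      flag-at : ∀ {C : Cycle G m} → CycleWalk C → ℕ → Flag
      flag-at W k = flag (at (1 + k)) (at k) (at (2 + k))
        where open CycleWalk W

      -- r₀ r₁ moves the flag one step along the walk ...
      walk-flags : ∀ {C : Cycle G m} (W : CycleWalk C) j → act* (alternate j r₀ r₁) (flag-at W 0) ≡ flag-at W j
      walk-flags W zero    = refl
      walk-flags W (suc j) = trans (cong (λ F → act r₀ (act r₁ F)) (walk-flags W j))
                                   (cong (flag (at (2 + j)) (at (1 + j))) (successor-walk W j))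
        where open CycleWalk W

      -- ... and m+1 steps close the face: (r₀ r₁)^(m+1) = 1
      relation-face : Relation (alternate (suc m) r₀ r₁)
      relation-face (flag v a b) arc@(_ , _ , a≢b) with girth-cycle arc
      ... | C , va , vb with walk-through C va vb a≢b
      ...   | W , refl , refl , refl =
        trans (walk-flags W (suc m)) (flag-≡ (periodic 1) (periodic 0) (periodic 2))
        where open CycleWalk W

      flag-relations : All Relation (flag-relators (suc m))
      flag-relations = AllP.++⁺ (rotations-relation (alternate 2 r₀ r₂) relation-02)
                      (AllP.++⁺ (rotations-relation (alternate 3 r₁ r₂) relation-12)
                                (rotations-relation (alternate (suc m) r₀ r₁) relation-face))

      neighbour-word : ∀ {F} → ValidFlag F → ∀ {x} → Adj G (vertex F) x →
                       Σ (List Gen) λ w → vertex (act* w F) ≡ x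
      neighbour-word {flag v a b} (va , vb , a≢b) {x} vx = choose (extend-neighbourhood cubic va vb a≢b)
        where
        choose : Σ V (Neighbourhood v a b) → Σ (List Gen) λ w → vertex (act* w (flag v a b)) ≡ x
        choose (c , N) = by-cases (Neighbourhood.covers N x vx)
          where
          by-cases : x ≡ a ⊎ x ≡ b ⊎ x ≡ c → Σ (List Gen) λ w → vertex (act* w (flag v a b)) ≡ x
          by-cases (inj₁ x≡a)        = r₀ ∷ [] , sym x≡a
          by-cases (inj₂ (inj₁ x≡b)) = r₀ ∷ r₁ ∷ [] , sym x≡b
          by-cases (inj₂ (inj₂ x≡c)) = r₀ ∷ r₁ ∷ r₂ ∷ [] , trans (third-spec N) (sym x≡c)

      vertex-bound : Connected G → ∀ {F₀ N} → Enumeration F₀ N → n G ≤ N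
      vertex-bound connected {F₀} {N} E = FinP.injective⇒≤ {f = index} index-injective
        where
        open Enumeration E
        Found : V → Set
        Found x = Σ ℕ λ p → p < N × vertex (element p) ≡ x
        reach : ∀ {u x} → Reachable G u x → Found u → Found x
        reach here found = found
        reach (step ux path) (p , p<N , at-u) =
          let w , reached = neighbour-word (element-valid p) (subst (λ u → Adj G u _) (sym at-u) ux)
              q<N , moved = move*-act w p<N
          in reach path (move* w p , q<N , trans (cong vertex (sym moved)) reached)
        found : ∀ x → Found x
        found x = reach (connected (vertex F₀) x) (0 , nonempty , cong vertex start)
        index : V → Fin N
        index x = fromℕ< (proj₁ (proj₂ (found x)))
        index-injective : ∀ {x y} → index x ≡ index y → x ≡ y
        index-injective {x} {y} e =
          trans (sym (proj₂ (proj₂ (found x))))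
                (trans (cong (λ p → vertex (element p)) (FinP.fromℕ<-injective _ _ _ _ e))
                       (proj₂ (proj₂ (found y))))

      bounded-by : Connected G → Cycle G m → (T : VerifiedTable (flag-relators (suc m))) →
                   n G ≤ CosetTable.size (VerifiedTable.table T)
      bounded-by connected C T =
        let a , b , c , N = neighbourhood cubic (vtx C zero)
            open Neighbourhood N
        in vertex-bound connected (enumerate T flag-relations {flag (vtx C zero) a b} (adj-a , adj-b , a≢b))

functions : ∀ {A : Set} → List A → (k : ℕ) → List (Fin k → A)
functions xs zero    = (λ ()) ∷ []
functions xs (suc k) = concatMap (λ a → map (a Vector.∷_) (functions xs k)) xs

functions-complete : ∀ {A : Set} (R : A → A → Set) (xs : List A) k (f : Fin k → A) →
  (∀ i → Any (λ a → R a (f i)) xs) → Any (λ g → ∀ i → R (g i) (f i)) (functions xs k)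
functions-complete R xs zero    f listed = here (λ ())
functions-complete R xs (suc k) f listed =
  AnyP.concatMap⁺ (λ a → map (a Vector.∷_) (functions xs k))
    (Any.map (λ Ra → AnyP.map⁺ (Any.map (extend Ra) rest)) (listed zero))
  where
  rest : Any (λ g → ∀ i → R (g i) (f (suc i))) (functions xs k)
  rest = functions-complete R xs k (λ i → f (suc i)) (λ i → listed (suc i))
  extend : ∀ {a g} → R a (f zero) → (∀ i → R (g i) (f (suc i))) → ∀ i → R ((a Vector.∷ g) i) (f i)
  extend Ra Rg zero    = Ra
  extend Ra Rg (suc i) = Rg i

symmetrise : ∀ {k} → (Fin k → Fin k → Bool) → Fin k → Fin k → Bool
symmetrise M u v with u ≟ v
... | yes _ = false
... | no _  = M u v ∧ M v u

graph : (k : ℕ) → (Fin k → Fin k → Bool) → Graph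
graph k M = record { n = k ; adj = symmetrise M ; sym = symmetric ; irrefl = irreflexive }
  where
  symmetric : ∀ u v → symmetrise M u v ≡ symmetrise M v u
  symmetric u v with u ≟ v | v ≟ u
  ... | yes _   | yes _   = refl
  ... | yes u≡v | no v≢u  = ⊥-elim (v≢u (sym u≡v))
  ... | no u≢v  | yes v≡u = ⊥-elim (u≢v (sym v≡u))
  ... | no _    | no _    = BoolP.∧-comm (M u v) (M v u)
  irreflexive : ∀ u → symmetrise M u u ≡ false
  irreflexive u with u ≟ u
  ... | yes _  = refl
  ... | no u≢u = ⊥-elim (u≢u refl)

graph-adj : ∀ G (M : Fin (n G) → Fin (n G) → Bool) → (∀ u v → M u v ≡ adj G u v) → G ≅ graph (n G) M
graph-adj G M same = record { iso = ↔-id _ ; preserve = preserve }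
  where
  preserve : ∀ u v → adj G u v ≡ symmetrise M u v
  preserve u v with u ≟ v
  ... | yes refl = Graph.irrefl G u
  ... | no _ rewrite same u v | same v u | Graph.sym G v u = sym (BoolP.∧-idem (adj G u v))

graphs-on : ℕ → List Graph
graphs-on k = map (graph k) (functions (functions (true ∷ false ∷ []) k) k)

graphs-up-to : ℕ → List Graph
graphs-up-to zero    = graphs-on zero
graphs-up-to (suc N) = graphs-on (suc N) ++ graphs-up-to N

in-graphs-on : ∀ G → Any (G ≅_) (graphs-on (n G))
in-graphs-on G = AnyP.map⁺ (Any.map (graph-adj G _) rows)
  where
  listed : ∀ b → Any (_≡ b) (true ∷ false ∷ [])
  listed true  = here refl
  listed false = there (here refl)
  rows : Any (λ M → ∀ u v → M u v ≡ adj G u v) (functions (functions (true ∷ false ∷ []) (n G)) (n G))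
  rows = functions-complete (λ g h → ∀ v → g v ≡ h v) _ (n G) (adj G)
           (λ u → functions-complete _≡_ _ (n G) (adj G u) (λ v → listed (adj G u v)))

in-graphs-up-to : ∀ G N → n G ≤ N → Any (G ≅_) (graphs-up-to N)
in-graphs-up-to G zero    z≤n = in-graphs-on G
in-graphs-up-to G (suc N) n≤N with n G ℕ.≟ suc N
... | yes n≡N = AnyP.++⁺ˡ (subst (λ k → Any (G ≅_) (graphs-on k)) n≡N (in-graphs-on G))
... | no n≢N  = AnyP.++⁺ʳ (graphs-on (suc N)) (in-graphs-up-to G N (ℕP.≤-pred (ℕP.≤∧≢⇒< n≤N n≢N)))

-- The flag groups [g,3] of the tetrahedron, cube and dodecahedron: coset
-- tables of the trivial subgroup, found by coset enumeration.
tetrahedron-flags : VerifiedTable (flag-relators 3)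
tetrahedron-flags = verify record
  { size       = 24
  ; action     = λ where
      r₀ → 1 ∷ 0 ∷ 6 ∷ 5 ∷ 9 ∷ 3 ∷ 2 ∷ 12 ∷ 14 ∷ 4 ∷ 15 ∷ 17 ∷ 7 ∷ 19 ∷ 8 ∷ 10 ∷ 21 ∷ 11 ∷ 22 ∷ 13 ∷ 23 ∷ 16 ∷ 18 ∷ 20 ∷ []
      r₁ → 2 ∷ 4 ∷ 0 ∷ 8 ∷ 1 ∷ 11 ∷ 9 ∷ 13 ∷ 3 ∷ 6 ∷ 16 ∷ 5 ∷ 18 ∷ 7 ∷ 17 ∷ 20 ∷ 10 ∷ 14 ∷ 12 ∷ 22 ∷ 15 ∷ 23 ∷ 19 ∷ 21 ∷ []
      r₂ → 3 ∷ 5 ∷ 7 ∷ 0 ∷ 10 ∷ 1 ∷ 12 ∷ 2 ∷ 13 ∷ 15 ∷ 4 ∷ 16 ∷ 6 ∷ 8 ∷ 19 ∷ 9 ∷ 11 ∷ 21 ∷ 20 ∷ 14 ∷ 18 ∷ 17 ∷ 23 ∷ 22 ∷ []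
  ; words      = [] ∷ (r₀ ∷ []) ∷ (r₁ ∷ []) ∷ (r₂ ∷ []) ∷ (r₁ ∷ r₀ ∷ []) ∷ (r₂ ∷ r₀ ∷ []) ∷ (r₀ ∷ r₁ ∷ []) ∷
                 (r₂ ∷ r₁ ∷ []) ∷ (r₁ ∷ r₂ ∷ []) ∷ (r₀ ∷ r₁ ∷ r₀ ∷ []) ∷ (r₂ ∷ r₁ ∷ r₀ ∷ []) ∷ (r₁ ∷ r₂ ∷ r₀ ∷ []) ∷
                 (r₂ ∷ r₀ ∷ r₁ ∷ []) ∷ (r₁ ∷ r₂ ∷ r₁ ∷ []) ∷ (r₀ ∷ r₁ ∷ r₂ ∷ []) ∷ (r₂ ∷ r₀ ∷ r₁ ∷ r₀ ∷ []) ∷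
                 (r₁ ∷ r₂ ∷ r₁ ∷ r₀ ∷ []) ∷ (r₀ ∷ r₁ ∷ r₂ ∷ r₀ ∷ []) ∷ (r₁ ∷ r₂ ∷ r₀ ∷ r₁ ∷ []) ∷
                 (r₀ ∷ r₁ ∷ r₂ ∷ r₁ ∷ []) ∷ (r₁ ∷ r₂ ∷ r₀ ∷ r₁ ∷ r₀ ∷ []) ∷ (r₀ ∷ r₁ ∷ r₂ ∷ r₁ ∷ r₀ ∷ []) ∷
                 (r₀ ∷ r₁ ∷ r₂ ∷ r₀ ∷ r₁ ∷ []) ∷ (r₀ ∷ r₁ ∷ r₂ ∷ r₀ ∷ r₁ ∷ r₀ ∷ []) ∷ []
  ; deductions = (0 , 3) ∷ (11 , 6) ∷ (0 , 7) ∷ (5 , 8) ∷ (0 , 10) ∷ (5 , 11) ∷ (1 , 14) ∷ (11 , 14) ∷ (1 , 17) ∷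
                 (5 , 18) ∷ (11 , 19) ∷ (11 , 21) ∷ (1 , 22) ∷ []
  }

cube-flags : VerifiedTable (flag-relators 4)
cube-flags = verify record
  { size       = 48
  ; action     = λ where
      r₀ → 1 ∷ 0 ∷ 6 ∷ 5 ∷ 9 ∷ 3 ∷ 2 ∷ 13 ∷ 15 ∷ 4 ∷ 17 ∷ 19 ∷ 16 ∷ 7 ∷ 22 ∷ 8 ∷ 12 ∷ 10 ∷ 26 ∷ 11 ∷ 24 ∷ 29 ∷ 14 ∷ 27 ∷
           20 ∷ 33 ∷ 18 ∷ 23 ∷ 36 ∷ 21 ∷ 37 ∷ 35 ∷ 39 ∷ 25 ∷ 40 ∷ 31 ∷ 28 ∷ 30 ∷ 43 ∷ 32 ∷ 34 ∷ 45 ∷ 44 ∷ 38 ∷ 42 ∷ 41 ∷ 47 ∷ 46 ∷ []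
      r₁ → 2 ∷ 4 ∷ 0 ∷ 8 ∷ 1 ∷ 11 ∷ 12 ∷ 14 ∷ 3 ∷ 16 ∷ 18 ∷ 5 ∷ 6 ∷ 21 ∷ 7 ∷ 23 ∷ 9 ∷ 25 ∷ 10 ∷ 27 ∷ 28 ∷ 13 ∷ 30 ∷ 15 ∷
           32 ∷ 17 ∷ 34 ∷ 19 ∷ 20 ∷ 37 ∷ 22 ∷ 38 ∷ 24 ∷ 40 ∷ 26 ∷ 41 ∷ 42 ∷ 29 ∷ 31 ∷ 44 ∷ 33 ∷ 35 ∷ 36 ∷ 46 ∷ 39 ∷ 47 ∷ 43 ∷ 45 ∷ []
      r₂ → 3 ∷ 5 ∷ 7 ∷ 0 ∷ 10 ∷ 1 ∷ 13 ∷ 2 ∷ 14 ∷ 17 ∷ 4 ∷ 18 ∷ 20 ∷ 6 ∷ 8 ∷ 22 ∷ 24 ∷ 9 ∷ 11 ∷ 26 ∷ 12 ∷ 28 ∷ 15 ∷ 31 ∷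
           16 ∷ 32 ∷ 19 ∷ 35 ∷ 21 ∷ 36 ∷ 38 ∷ 23 ∷ 25 ∷ 39 ∷ 41 ∷ 27 ∷ 29 ∷ 43 ∷ 30 ∷ 33 ∷ 45 ∷ 34 ∷ 46 ∷ 37 ∷ 47 ∷ 40 ∷ 42 ∷ 44 ∷ []
  ; words      = [] ∷ (r₀ ∷ []) ∷ (r₁ ∷ []) ∷ (r₂ ∷ []) ∷ (r₁ ∷ r₀ ∷ []) ∷ (r₂ ∷ r₀ ∷ []) ∷ (r₀ ∷ r₁ ∷ []) ∷
                 (r₂ ∷ r₁ ∷ []) ∷ (r₁ ∷ r₂ ∷ []) ∷ (r₀ ∷ r₁ ∷ r₀ ∷ []) ∷ (r₂ ∷ r₁ ∷ r₀ ∷ []) ∷ (r₁ ∷ r₂ ∷ r₀ ∷ []) ∷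
                 (r₁ ∷ r₀ ∷ r₁ ∷ []) ∷ (r₂ ∷ r₀ ∷ r₁ ∷ []) ∷ (r₁ ∷ r₂ ∷ r₁ ∷ []) ∷ (r₀ ∷ r₁ ∷ r₂ ∷ []) ∷
                 (r₁ ∷ r₀ ∷ r₁ ∷ r₀ ∷ []) ∷ (r₂ ∷ r₀ ∷ r₁ ∷ r₀ ∷ []) ∷ (r₁ ∷ r₂ ∷ r₁ ∷ r₀ ∷ []) ∷
                 (r₀ ∷ r₁ ∷ r₂ ∷ r₀ ∷ []) ∷ (r₂ ∷ r₁ ∷ r₀ ∷ r₁ ∷ []) ∷ (r₁ ∷ r₂ ∷ r₀ ∷ r₁ ∷ []) ∷
                 (r₀ ∷ r₁ ∷ r₂ ∷ r₁ ∷ []) ∷ (r₁ ∷ r₀ ∷ r₁ ∷ r₂ ∷ []) ∷ (r₂ ∷ r₁ ∷ r₀ ∷ r₁ ∷ r₀ ∷ []) ∷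
                 (r₁ ∷ r₂ ∷ r₀ ∷ r₁ ∷ r₀ ∷ []) ∷ (r₀ ∷ r₁ ∷ r₂ ∷ r₁ ∷ r₀ ∷ []) ∷ (r₁ ∷ r₀ ∷ r₁ ∷ r₂ ∷ r₀ ∷ []) ∷
                 (r₁ ∷ r₂ ∷ r₁ ∷ r₀ ∷ r₁ ∷ []) ∷ (r₀ ∷ r₁ ∷ r₂ ∷ r₀ ∷ r₁ ∷ []) ∷ (r₁ ∷ r₀ ∷ r₁ ∷ r₂ ∷ r₁ ∷ []) ∷
                 (r₂ ∷ r₁ ∷ r₀ ∷ r₁ ∷ r₂ ∷ []) ∷ (r₁ ∷ r₂ ∷ r₁ ∷ r₀ ∷ r₁ ∷ r₀ ∷ []) ∷
                 (r₀ ∷ r₁ ∷ r₂ ∷ r₀ ∷ r₁ ∷ r₀ ∷ []) ∷ (r₁ ∷ r₀ ∷ r₁ ∷ r₂ ∷ r₁ ∷ r₀ ∷ []) ∷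
                 (r₂ ∷ r₁ ∷ r₀ ∷ r₁ ∷ r₂ ∷ r₀ ∷ []) ∷ (r₀ ∷ r₁ ∷ r₂ ∷ r₁ ∷ r₀ ∷ r₁ ∷ []) ∷
                 (r₁ ∷ r₀ ∷ r₁ ∷ r₂ ∷ r₀ ∷ r₁ ∷ []) ∷ (r₂ ∷ r₁ ∷ r₀ ∷ r₁ ∷ r₂ ∷ r₁ ∷ []) ∷
                 (r₀ ∷ r₁ ∷ r₂ ∷ r₁ ∷ r₀ ∷ r₁ ∷ r₀ ∷ []) ∷ (r₁ ∷ r₀ ∷ r₁ ∷ r₂ ∷ r₀ ∷ r₁ ∷ r₀ ∷ []) ∷
                 (r₂ ∷ r₁ ∷ r₀ ∷ r₁ ∷ r₂ ∷ r₁ ∷ r₀ ∷ []) ∷ (r₁ ∷ r₀ ∷ r₁ ∷ r₂ ∷ r₁ ∷ r₀ ∷ r₁ ∷ []) ∷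
                 (r₂ ∷ r₁ ∷ r₀ ∷ r₁ ∷ r₂ ∷ r₀ ∷ r₁ ∷ []) ∷ (r₁ ∷ r₀ ∷ r₁ ∷ r₂ ∷ r₁ ∷ r₀ ∷ r₁ ∷ r₀ ∷ []) ∷
                 (r₂ ∷ r₁ ∷ r₀ ∷ r₁ ∷ r₂ ∷ r₀ ∷ r₁ ∷ r₀ ∷ []) ∷ (r₂ ∷ r₁ ∷ r₀ ∷ r₁ ∷ r₂ ∷ r₁ ∷ r₀ ∷ r₁ ∷ []) ∷
                 (r₂ ∷ r₁ ∷ r₀ ∷ r₁ ∷ r₂ ∷ r₁ ∷ r₀ ∷ r₁ ∷ r₀ ∷ []) ∷ []
  ; deductions = (0 , 3) ∷ (0 , 7) ∷ (5 , 8) ∷ (0 , 10) ∷ (5 , 11) ∷ (10 , 12) ∷ (1 , 15) ∷ (1 , 19) ∷ (0 , 20) ∷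
                 (5 , 21) ∷ (10 , 23) ∷ (5 , 25) ∷ (1 , 29) ∷ (10 , 30) ∷ (0 , 31) ∷ (4 , 31) ∷ (1 , 33) ∷
                 (10 , 34) ∷ (4 , 35) ∷ (0 , 38) ∷ (0 , 41) ∷ (10 , 42) ∷ (4 , 43) ∷ (4 , 45) ∷ (0 , 46) ∷ []
  }

dodecahedron-flags : VerifiedTable (flag-relators 5)
dodecahedron-flags = verify record
  { size       = 120
  ; action     = λ where
      r₀ → 1 ∷ 0 ∷ 6 ∷ 5 ∷ 9 ∷ 3 ∷ 2 ∷ 13 ∷ 15 ∷ 4 ∷ 17 ∷ 19 ∷ 20 ∷ 7 ∷ 23 ∷ 8 ∷ 25 ∷ 10 ∷ 28 ∷ 11 ∷ 12 ∷ 30 ∷ 32 ∷ 14 ∷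
           34 ∷ 16 ∷ 36 ∷ 38 ∷ 18 ∷ 40 ∷ 21 ∷ 43 ∷ 22 ∷ 45 ∷ 24 ∷ 47 ∷ 26 ∷ 49 ∷ 27 ∷ 51 ∷ 29 ∷ 53 ∷ 54 ∷ 31 ∷ 56 ∷ 33 ∷ 58 ∷ 35 ∷
           60 ∷ 37 ∷ 62 ∷ 39 ∷ 64 ∷ 41 ∷ 42 ∷ 67 ∷ 44 ∷ 69 ∷ 46 ∷ 71 ∷ 48 ∷ 73 ∷ 50 ∷ 75 ∷ 52 ∷ 77 ∷ 78 ∷ 55 ∷ 80 ∷ 57 ∷ 82 ∷ 59 ∷
           84 ∷ 61 ∷ 86 ∷ 63 ∷ 88 ∷ 65 ∷ 66 ∷ 90 ∷ 68 ∷ 92 ∷ 70 ∷ 93 ∷ 72 ∷ 95 ∷ 74 ∷ 97 ∷ 76 ∷ 98 ∷ 79 ∷ 101 ∷ 81 ∷ 83 ∷ 103 ∷ 85 ∷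
           105 ∷ 87 ∷ 89 ∷ 107 ∷ 108 ∷ 91 ∷ 109 ∷ 94 ∷ 111 ∷ 96 ∷ 112 ∷ 99 ∷ 100 ∷ 102 ∷ 115 ∷ 104 ∷ 106 ∷ 117 ∷ 116 ∷ 110 ∷ 114 ∷ 113 ∷ 119 ∷ 118 ∷ []
      r₁ → 2 ∷ 4 ∷ 0 ∷ 8 ∷ 1 ∷ 11 ∷ 12 ∷ 14 ∷ 3 ∷ 16 ∷ 18 ∷ 5 ∷ 6 ∷ 22 ∷ 7 ∷ 24 ∷ 9 ∷ 27 ∷ 10 ∷ 29 ∷ 25 ∷ 31 ∷ 13 ∷ 33 ∷
           15 ∷ 20 ∷ 37 ∷ 17 ∷ 39 ∷ 19 ∷ 42 ∷ 21 ∷ 44 ∷ 23 ∷ 40 ∷ 46 ∷ 48 ∷ 26 ∷ 50 ∷ 28 ∷ 34 ∷ 52 ∷ 30 ∷ 55 ∷ 32 ∷ 56 ∷ 35 ∷ 59 ∷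
           36 ∷ 61 ∷ 38 ∷ 62 ∷ 41 ∷ 65 ∷ 66 ∷ 43 ∷ 45 ∷ 68 ∷ 70 ∷ 47 ∷ 72 ∷ 49 ∷ 51 ∷ 74 ∷ 76 ∷ 53 ∷ 54 ∷ 78 ∷ 57 ∷ 81 ∷ 58 ∷ 83 ∷
           60 ∷ 84 ∷ 63 ∷ 87 ∷ 64 ∷ 89 ∷ 67 ∷ 85 ∷ 91 ∷ 69 ∷ 93 ∷ 71 ∷ 73 ∷ 79 ∷ 96 ∷ 75 ∷ 98 ∷ 77 ∷ 100 ∷ 80 ∷ 102 ∷ 82 ∷ 99 ∷ 104 ∷
           86 ∷ 106 ∷ 88 ∷ 94 ∷ 90 ∷ 109 ∷ 92 ∷ 110 ∷ 95 ∷ 112 ∷ 97 ∷ 113 ∷ 114 ∷ 101 ∷ 103 ∷ 116 ∷ 105 ∷ 107 ∷ 108 ∷ 118 ∷ 111 ∷ 119 ∷ 115 ∷ 117 ∷ []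
      r₂ → 3 ∷ 5 ∷ 7 ∷ 0 ∷ 10 ∷ 1 ∷ 13 ∷ 2 ∷ 14 ∷ 17 ∷ 4 ∷ 18 ∷ 21 ∷ 6 ∷ 8 ∷ 23 ∷ 26 ∷ 9 ∷ 11 ∷ 28 ∷ 30 ∷ 12 ∷ 31 ∷ 15 ∷
           35 ∷ 36 ∷ 16 ∷ 37 ∷ 19 ∷ 41 ∷ 20 ∷ 22 ∷ 43 ∷ 46 ∷ 47 ∷ 24 ∷ 25 ∷ 27 ∷ 49 ∷ 52 ∷ 53 ∷ 29 ∷ 48 ∷ 32 ∷ 57 ∷ 58 ∷ 33 ∷ 34 ∷
           42 ∷ 38 ∷ 63 ∷ 64 ∷ 39 ∷ 40 ∷ 60 ∷ 68 ∷ 69 ∷ 44 ∷ 45 ∷ 65 ∷ 54 ∷ 74 ∷ 75 ∷ 50 ∷ 51 ∷ 59 ∷ 79 ∷ 80 ∷ 55 ∷ 56 ∷ 81 ∷ 77 ∷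
           85 ∷ 86 ∷ 61 ∷ 62 ∷ 87 ∷ 71 ∷ 90 ∷ 66 ∷ 67 ∷ 70 ∷ 92 ∷ 94 ∷ 95 ∷ 72 ∷ 73 ∷ 76 ∷ 97 ∷ 99 ∷ 78 ∷ 100 ∷ 82 ∷ 103 ∷ 83 ∷ 84 ∷
           104 ∷ 88 ∷ 107 ∷ 89 ∷ 91 ∷ 108 ∷ 110 ∷ 93 ∷ 96 ∷ 111 ∷ 113 ∷ 98 ∷ 101 ∷ 115 ∷ 102 ∷ 105 ∷ 117 ∷ 106 ∷ 118 ∷ 109 ∷ 119 ∷ 112 ∷ 114 ∷ 116 ∷ []
  ; words      = [] ∷ (r₀ ∷ []) ∷ (r₁ ∷ []) ∷ (r₂ ∷ []) ∷ (r₁ ∷ r₀ ∷ []) ∷ (r₂ ∷ r₀ ∷ []) ∷ (r₀ ∷ r₁ ∷ []) ∷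
                 (r₂ ∷ r₁ ∷ []) ∷ (r₁ ∷ r₂ ∷ []) ∷ (r₀ ∷ r₁ ∷ r₀ ∷ []) ∷ (r₂ ∷ r₁ ∷ r₀ ∷ []) ∷ (r₁ ∷ r₂ ∷ r₀ ∷ []) ∷
                 (r₁ ∷ r₀ ∷ r₁ ∷ []) ∷ (r₂ ∷ r₀ ∷ r₁ ∷ []) ∷ (r₁ ∷ r₂ ∷ r₁ ∷ []) ∷ (r₀ ∷ r₁ ∷ r₂ ∷ []) ∷
                 (r₁ ∷ r₀ ∷ r₁ ∷ r₀ ∷ []) ∷ (r₂ ∷ r₀ ∷ r₁ ∷ r₀ ∷ []) ∷ (r₁ ∷ r₂ ∷ r₁ ∷ r₀ ∷ []) ∷
                 (r₀ ∷ r₁ ∷ r₂ ∷ r₀ ∷ []) ∷ (r₀ ∷ r₁ ∷ r₀ ∷ r₁ ∷ []) ∷ (r₂ ∷ r₁ ∷ r₀ ∷ r₁ ∷ []) ∷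
                 (r₁ ∷ r₂ ∷ r₀ ∷ r₁ ∷ []) ∷ (r₀ ∷ r₁ ∷ r₂ ∷ r₁ ∷ []) ∷ (r₁ ∷ r₀ ∷ r₁ ∷ r₂ ∷ []) ∷
                 (r₀ ∷ r₁ ∷ r₀ ∷ r₁ ∷ r₀ ∷ []) ∷ (r₂ ∷ r₁ ∷ r₀ ∷ r₁ ∷ r₀ ∷ []) ∷ (r₁ ∷ r₂ ∷ r₀ ∷ r₁ ∷ r₀ ∷ []) ∷
                 (r₀ ∷ r₁ ∷ r₂ ∷ r₁ ∷ r₀ ∷ []) ∷ (r₁ ∷ r₀ ∷ r₁ ∷ r₂ ∷ r₀ ∷ []) ∷ (r₂ ∷ r₀ ∷ r₁ ∷ r₀ ∷ r₁ ∷ []) ∷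
                 (r₁ ∷ r₂ ∷ r₁ ∷ r₀ ∷ r₁ ∷ []) ∷ (r₀ ∷ r₁ ∷ r₂ ∷ r₀ ∷ r₁ ∷ []) ∷ (r₁ ∷ r₀ ∷ r₁ ∷ r₂ ∷ r₁ ∷ []) ∷
                 (r₀ ∷ r₁ ∷ r₀ ∷ r₁ ∷ r₂ ∷ []) ∷ (r₂ ∷ r₁ ∷ r₀ ∷ r₁ ∷ r₂ ∷ []) ∷
                 (r₂ ∷ r₀ ∷ r₁ ∷ r₀ ∷ r₁ ∷ r₀ ∷ []) ∷ (r₁ ∷ r₂ ∷ r₁ ∷ r₀ ∷ r₁ ∷ r₀ ∷ []) ∷
                 (r₀ ∷ r₁ ∷ r₂ ∷ r₀ ∷ r₁ ∷ r₀ ∷ []) ∷ (r₁ ∷ r₀ ∷ r₁ ∷ r₂ ∷ r₁ ∷ r₀ ∷ []) ∷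
                 (r₀ ∷ r₁ ∷ r₀ ∷ r₁ ∷ r₂ ∷ r₀ ∷ []) ∷ (r₂ ∷ r₁ ∷ r₀ ∷ r₁ ∷ r₂ ∷ r₀ ∷ []) ∷
                 (r₁ ∷ r₂ ∷ r₀ ∷ r₁ ∷ r₀ ∷ r₁ ∷ []) ∷ (r₀ ∷ r₁ ∷ r₂ ∷ r₁ ∷ r₀ ∷ r₁ ∷ []) ∷
                 (r₁ ∷ r₀ ∷ r₁ ∷ r₂ ∷ r₀ ∷ r₁ ∷ []) ∷ (r₀ ∷ r₁ ∷ r₀ ∷ r₁ ∷ r₂ ∷ r₁ ∷ []) ∷
                 (r₂ ∷ r₁ ∷ r₀ ∷ r₁ ∷ r₂ ∷ r₁ ∷ []) ∷ (r₂ ∷ r₀ ∷ r₁ ∷ r₀ ∷ r₁ ∷ r₂ ∷ []) ∷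
                 (r₁ ∷ r₂ ∷ r₀ ∷ r₁ ∷ r₀ ∷ r₁ ∷ r₀ ∷ []) ∷ (r₀ ∷ r₁ ∷ r₂ ∷ r₁ ∷ r₀ ∷ r₁ ∷ r₀ ∷ []) ∷
                 (r₁ ∷ r₀ ∷ r₁ ∷ r₂ ∷ r₀ ∷ r₁ ∷ r₀ ∷ []) ∷ (r₀ ∷ r₁ ∷ r₀ ∷ r₁ ∷ r₂ ∷ r₁ ∷ r₀ ∷ []) ∷
                 (r₂ ∷ r₁ ∷ r₀ ∷ r₁ ∷ r₂ ∷ r₁ ∷ r₀ ∷ []) ∷ (r₂ ∷ r₀ ∷ r₁ ∷ r₀ ∷ r₁ ∷ r₂ ∷ r₀ ∷ []) ∷
                 (r₀ ∷ r₁ ∷ r₂ ∷ r₀ ∷ r₁ ∷ r₀ ∷ r₁ ∷ []) ∷ (r₁ ∷ r₀ ∷ r₁ ∷ r₂ ∷ r₁ ∷ r₀ ∷ r₁ ∷ []) ∷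
                 (r₀ ∷ r₁ ∷ r₀ ∷ r₁ ∷ r₂ ∷ r₀ ∷ r₁ ∷ []) ∷ (r₂ ∷ r₁ ∷ r₀ ∷ r₁ ∷ r₂ ∷ r₀ ∷ r₁ ∷ []) ∷
                 (r₂ ∷ r₀ ∷ r₁ ∷ r₀ ∷ r₁ ∷ r₂ ∷ r₁ ∷ []) ∷ (r₁ ∷ r₂ ∷ r₀ ∷ r₁ ∷ r₀ ∷ r₁ ∷ r₂ ∷ []) ∷
                 (r₀ ∷ r₁ ∷ r₂ ∷ r₀ ∷ r₁ ∷ r₀ ∷ r₁ ∷ r₀ ∷ []) ∷ (r₁ ∷ r₀ ∷ r₁ ∷ r₂ ∷ r₁ ∷ r₀ ∷ r₁ ∷ r₀ ∷ []) ∷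
                 (r₀ ∷ r₁ ∷ r₀ ∷ r₁ ∷ r₂ ∷ r₀ ∷ r₁ ∷ r₀ ∷ []) ∷ (r₂ ∷ r₁ ∷ r₀ ∷ r₁ ∷ r₂ ∷ r₀ ∷ r₁ ∷ r₀ ∷ []) ∷
                 (r₂ ∷ r₀ ∷ r₁ ∷ r₀ ∷ r₁ ∷ r₂ ∷ r₁ ∷ r₀ ∷ []) ∷ (r₁ ∷ r₂ ∷ r₀ ∷ r₁ ∷ r₀ ∷ r₁ ∷ r₂ ∷ r₀ ∷ []) ∷
                 (r₁ ∷ r₀ ∷ r₁ ∷ r₂ ∷ r₀ ∷ r₁ ∷ r₀ ∷ r₁ ∷ []) ∷ (r₀ ∷ r₁ ∷ r₀ ∷ r₁ ∷ r₂ ∷ r₁ ∷ r₀ ∷ r₁ ∷ []) ∷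
                 (r₂ ∷ r₁ ∷ r₀ ∷ r₁ ∷ r₂ ∷ r₁ ∷ r₀ ∷ r₁ ∷ []) ∷ (r₂ ∷ r₀ ∷ r₁ ∷ r₀ ∷ r₁ ∷ r₂ ∷ r₀ ∷ r₁ ∷ []) ∷
                 (r₁ ∷ r₂ ∷ r₀ ∷ r₁ ∷ r₀ ∷ r₁ ∷ r₂ ∷ r₁ ∷ []) ∷ (r₀ ∷ r₁ ∷ r₂ ∷ r₀ ∷ r₁ ∷ r₀ ∷ r₁ ∷ r₂ ∷ []) ∷
                 (r₁ ∷ r₀ ∷ r₁ ∷ r₂ ∷ r₀ ∷ r₁ ∷ r₀ ∷ r₁ ∷ r₀ ∷ []) ∷
                 (r₀ ∷ r₁ ∷ r₀ ∷ r₁ ∷ r₂ ∷ r₁ ∷ r₀ ∷ r₁ ∷ r₀ ∷ []) ∷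
                 (r₂ ∷ r₁ ∷ r₀ ∷ r₁ ∷ r₂ ∷ r₁ ∷ r₀ ∷ r₁ ∷ r₀ ∷ []) ∷
                 (r₂ ∷ r₀ ∷ r₁ ∷ r₀ ∷ r₁ ∷ r₂ ∷ r₀ ∷ r₁ ∷ r₀ ∷ []) ∷
                 (r₁ ∷ r₂ ∷ r₀ ∷ r₁ ∷ r₀ ∷ r₁ ∷ r₂ ∷ r₁ ∷ r₀ ∷ []) ∷
                 (r₀ ∷ r₁ ∷ r₂ ∷ r₀ ∷ r₁ ∷ r₀ ∷ r₁ ∷ r₂ ∷ r₀ ∷ []) ∷
                 (r₀ ∷ r₁ ∷ r₀ ∷ r₁ ∷ r₂ ∷ r₀ ∷ r₁ ∷ r₀ ∷ r₁ ∷ []) ∷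
                 (r₂ ∷ r₁ ∷ r₀ ∷ r₁ ∷ r₂ ∷ r₀ ∷ r₁ ∷ r₀ ∷ r₁ ∷ []) ∷
                 (r₂ ∷ r₀ ∷ r₁ ∷ r₀ ∷ r₁ ∷ r₂ ∷ r₁ ∷ r₀ ∷ r₁ ∷ []) ∷
                 (r₁ ∷ r₂ ∷ r₀ ∷ r₁ ∷ r₀ ∷ r₁ ∷ r₂ ∷ r₀ ∷ r₁ ∷ []) ∷
                 (r₀ ∷ r₁ ∷ r₂ ∷ r₀ ∷ r₁ ∷ r₀ ∷ r₁ ∷ r₂ ∷ r₁ ∷ []) ∷
                 (r₁ ∷ r₀ ∷ r₁ ∷ r₂ ∷ r₀ ∷ r₁ ∷ r₀ ∷ r₁ ∷ r₂ ∷ []) ∷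
                 (r₀ ∷ r₁ ∷ r₀ ∷ r₁ ∷ r₂ ∷ r₀ ∷ r₁ ∷ r₀ ∷ r₁ ∷ r₀ ∷ []) ∷
                 (r₂ ∷ r₁ ∷ r₀ ∷ r₁ ∷ r₂ ∷ r₀ ∷ r₁ ∷ r₀ ∷ r₁ ∷ r₀ ∷ []) ∷
                 (r₂ ∷ r₀ ∷ r₁ ∷ r₀ ∷ r₁ ∷ r₂ ∷ r₁ ∷ r₀ ∷ r₁ ∷ r₀ ∷ []) ∷
                 (r₁ ∷ r₂ ∷ r₀ ∷ r₁ ∷ r₀ ∷ r₁ ∷ r₂ ∷ r₀ ∷ r₁ ∷ r₀ ∷ []) ∷
                 (r₀ ∷ r₁ ∷ r₂ ∷ r₀ ∷ r₁ ∷ r₀ ∷ r₁ ∷ r₂ ∷ r₁ ∷ r₀ ∷ []) ∷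
                 (r₁ ∷ r₀ ∷ r₁ ∷ r₂ ∷ r₀ ∷ r₁ ∷ r₀ ∷ r₁ ∷ r₂ ∷ r₀ ∷ []) ∷
                 (r₂ ∷ r₀ ∷ r₁ ∷ r₀ ∷ r₁ ∷ r₂ ∷ r₀ ∷ r₁ ∷ r₀ ∷ r₁ ∷ []) ∷
                 (r₁ ∷ r₂ ∷ r₀ ∷ r₁ ∷ r₀ ∷ r₁ ∷ r₂ ∷ r₁ ∷ r₀ ∷ r₁ ∷ []) ∷
                 (r₀ ∷ r₁ ∷ r₂ ∷ r₀ ∷ r₁ ∷ r₀ ∷ r₁ ∷ r₂ ∷ r₀ ∷ r₁ ∷ []) ∷
                 (r₁ ∷ r₀ ∷ r₁ ∷ r₂ ∷ r₀ ∷ r₁ ∷ r₀ ∷ r₁ ∷ r₂ ∷ r₁ ∷ []) ∷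
                 (r₂ ∷ r₁ ∷ r₀ ∷ r₁ ∷ r₂ ∷ r₀ ∷ r₁ ∷ r₀ ∷ r₁ ∷ r₂ ∷ []) ∷
                 (r₂ ∷ r₀ ∷ r₁ ∷ r₀ ∷ r₁ ∷ r₂ ∷ r₀ ∷ r₁ ∷ r₀ ∷ r₁ ∷ r₀ ∷ []) ∷
                 (r₁ ∷ r₂ ∷ r₀ ∷ r₁ ∷ r₀ ∷ r₁ ∷ r₂ ∷ r₁ ∷ r₀ ∷ r₁ ∷ r₀ ∷ []) ∷
                 (r₀ ∷ r₁ ∷ r₂ ∷ r₀ ∷ r₁ ∷ r₀ ∷ r₁ ∷ r₂ ∷ r₀ ∷ r₁ ∷ r₀ ∷ []) ∷
                 (r₁ ∷ r₀ ∷ r₁ ∷ r₂ ∷ r₀ ∷ r₁ ∷ r₀ ∷ r₁ ∷ r₂ ∷ r₁ ∷ r₀ ∷ []) ∷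
                 (r₂ ∷ r₁ ∷ r₀ ∷ r₁ ∷ r₂ ∷ r₀ ∷ r₁ ∷ r₀ ∷ r₁ ∷ r₂ ∷ r₀ ∷ []) ∷
                 (r₁ ∷ r₂ ∷ r₀ ∷ r₁ ∷ r₀ ∷ r₁ ∷ r₂ ∷ r₀ ∷ r₁ ∷ r₀ ∷ r₁ ∷ []) ∷
                 (r₀ ∷ r₁ ∷ r₂ ∷ r₀ ∷ r₁ ∷ r₀ ∷ r₁ ∷ r₂ ∷ r₁ ∷ r₀ ∷ r₁ ∷ []) ∷
                 (r₁ ∷ r₀ ∷ r₁ ∷ r₂ ∷ r₀ ∷ r₁ ∷ r₀ ∷ r₁ ∷ r₂ ∷ r₀ ∷ r₁ ∷ []) ∷
                 (r₂ ∷ r₁ ∷ r₀ ∷ r₁ ∷ r₂ ∷ r₀ ∷ r₁ ∷ r₀ ∷ r₁ ∷ r₂ ∷ r₁ ∷ []) ∷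
                 (r₁ ∷ r₂ ∷ r₀ ∷ r₁ ∷ r₀ ∷ r₁ ∷ r₂ ∷ r₀ ∷ r₁ ∷ r₀ ∷ r₁ ∷ r₀ ∷ []) ∷
                 (r₀ ∷ r₁ ∷ r₂ ∷ r₀ ∷ r₁ ∷ r₀ ∷ r₁ ∷ r₂ ∷ r₁ ∷ r₀ ∷ r₁ ∷ r₀ ∷ []) ∷
                 (r₁ ∷ r₀ ∷ r₁ ∷ r₂ ∷ r₀ ∷ r₁ ∷ r₀ ∷ r₁ ∷ r₂ ∷ r₀ ∷ r₁ ∷ r₀ ∷ []) ∷
                 (r₂ ∷ r₁ ∷ r₀ ∷ r₁ ∷ r₂ ∷ r₀ ∷ r₁ ∷ r₀ ∷ r₁ ∷ r₂ ∷ r₁ ∷ r₀ ∷ []) ∷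
                 (r₀ ∷ r₁ ∷ r₂ ∷ r₀ ∷ r₁ ∷ r₀ ∷ r₁ ∷ r₂ ∷ r₀ ∷ r₁ ∷ r₀ ∷ r₁ ∷ []) ∷
                 (r₁ ∷ r₀ ∷ r₁ ∷ r₂ ∷ r₀ ∷ r₁ ∷ r₀ ∷ r₁ ∷ r₂ ∷ r₁ ∷ r₀ ∷ r₁ ∷ []) ∷
                 (r₂ ∷ r₁ ∷ r₀ ∷ r₁ ∷ r₂ ∷ r₀ ∷ r₁ ∷ r₀ ∷ r₁ ∷ r₂ ∷ r₀ ∷ r₁ ∷ []) ∷
                 (r₀ ∷ r₁ ∷ r₂ ∷ r₀ ∷ r₁ ∷ r₀ ∷ r₁ ∷ r₂ ∷ r₀ ∷ r₁ ∷ r₀ ∷ r₁ ∷ r₀ ∷ []) ∷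
                 (r₁ ∷ r₀ ∷ r₁ ∷ r₂ ∷ r₀ ∷ r₁ ∷ r₀ ∷ r₁ ∷ r₂ ∷ r₁ ∷ r₀ ∷ r₁ ∷ r₀ ∷ []) ∷
                 (r₂ ∷ r₁ ∷ r₀ ∷ r₁ ∷ r₂ ∷ r₀ ∷ r₁ ∷ r₀ ∷ r₁ ∷ r₂ ∷ r₀ ∷ r₁ ∷ r₀ ∷ []) ∷
                 (r₁ ∷ r₀ ∷ r₁ ∷ r₂ ∷ r₀ ∷ r₁ ∷ r₀ ∷ r₁ ∷ r₂ ∷ r₀ ∷ r₁ ∷ r₀ ∷ r₁ ∷ []) ∷
                 (r₂ ∷ r₁ ∷ r₀ ∷ r₁ ∷ r₂ ∷ r₀ ∷ r₁ ∷ r₀ ∷ r₁ ∷ r₂ ∷ r₁ ∷ r₀ ∷ r₁ ∷ []) ∷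
                 (r₁ ∷ r₀ ∷ r₁ ∷ r₂ ∷ r₀ ∷ r₁ ∷ r₀ ∷ r₁ ∷ r₂ ∷ r₀ ∷ r₁ ∷ r₀ ∷ r₁ ∷ r₀ ∷ []) ∷
                 (r₂ ∷ r₁ ∷ r₀ ∷ r₁ ∷ r₂ ∷ r₀ ∷ r₁ ∷ r₀ ∷ r₁ ∷ r₂ ∷ r₁ ∷ r₀ ∷ r₁ ∷ r₀ ∷ []) ∷
                 (r₂ ∷ r₁ ∷ r₀ ∷ r₁ ∷ r₂ ∷ r₀ ∷ r₁ ∷ r₀ ∷ r₁ ∷ r₂ ∷ r₀ ∷ r₁ ∷ r₀ ∷ r₁ ∷ []) ∷
                 (r₂ ∷ r₁ ∷ r₀ ∷ r₁ ∷ r₂ ∷ r₀ ∷ r₁ ∷ r₀ ∷ r₁ ∷ r₂ ∷ r₀ ∷ r₁ ∷ r₀ ∷ r₁ ∷ r₀ ∷ []) ∷ []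
  ; deductions = (0 , 3) ∷ (0 , 7) ∷ (5 , 8) ∷ (0 , 10) ∷ (5 , 11) ∷ (1 , 15) ∷ (1 , 19) ∷ (11 , 20) ∷ (0 , 21) ∷
                 (5 , 22) ∷ (0 , 26) ∷ (5 , 27) ∷ (1 , 32) ∷ (11 , 34) ∷ (0 , 35) ∷ (4 , 35) ∷ (1 , 38) ∷ (0 , 41) ∷
                 (4 , 41) ∷ (5 , 42) ∷ (11 , 45) ∷ (0 , 46) ∷ (11 , 51) ∷ (0 , 52) ∷ (1 , 54) ∷ (0 , 57) ∷
                 (4 , 57) ∷ (5 , 59) ∷ (0 , 63) ∷ (4 , 63) ∷ (11 , 67) ∷ (0 , 68) ∷ (5 , 70) ∷ (1 , 71) ∷
                 (11 , 73) ∷ (0 , 74) ∷ (5 , 76) ∷ (0 , 79) ∷ (4 , 79) ∷ (1 , 82) ∷ (10 , 83) ∷ (0 , 85) ∷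
                 (1 , 88) ∷ (10 , 89) ∷ (5 , 91) ∷ (0 , 94) ∷ (4 , 94) ∷ (5 , 96) ∷ (0 , 99) ∷ (1 , 101) ∷
                 (10 , 102) ∷ (4 , 103) ∷ (1 , 105) ∷ (10 , 106) ∷ (4 , 107) ∷ (0 , 110) ∷ (0 , 113) ∷ (10 , 114) ∷
                 (4 , 115) ∷ (4 , 117) ∷ (0 , 118) ∷ []
  }

-- A connected cubic girth-regular graph of signature (2,2,2) and girth
-- g ≤ 5 has at most |[g,3]| ≤ 120 vertices. (Only the length of the girth
-- cycles matters here, not the minimality of the girth.)
order-bound : ∀ G → Connected G → Cubic G → ∀ m → HasGirth G (suc m) → suc m ≤ 5 →
              GirthRegular222 G m → n G ≤ 120
order-bound G connected cubic m (C , _) = by-girth m C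
  where
  bound : ∀ {m} → GirthRegular222 G m → Cycle G m → (T : VerifiedTable (flag-relators (suc m))) →
          n G ≤ CosetTable.size (VerifiedTable.table T)
  bound regular = Faces.bounded-by G cubic regular connected
  by-girth : ∀ m → Cycle G m → suc m ≤ 5 → GirthRegular222 G m → n G ≤ 120
  by-girth 0 C _ _ with Cycle.len≥3 C
  ... | ()
  by-girth 1 C _ _ with Cycle.len≥3 C
  ... | s≤s ()
  by-girth 2 C _ regular = ℕP.≤-trans (bound regular C tetrahedron-flags) (ℕP.m≤m+n 24 96)
  by-girth 3 C _ regular = ℕP.≤-trans (bound regular C cube-flags) (ℕP.m≤m+n 48 72)
  by-girth 4 C _ regular = bound regular C dodecahedron-flags
  by-girth (suc (suc (suc (suc (suc m))))) C (s≤s (s≤s (s≤s (s≤s (s≤s ()))))) _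

corollary3p12 : ∃ λ (L : List Graph) →
    ∀ (G : Graph) → Connected G → Cubic G →
      ∀ (m : ℕ) → HasGirth G (suc m) → suc m ≤ 5 → GirthRegular222 G m →
      Any (λ H → G ≅ H) L
corollary3p12 = graphs-up-to 120 , λ G connected cubic m girth girth≤5 regular →
  in-graphs-up-to G 120 (order-bound G connected cubic m girth girth≤5 regular)
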